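{- Let $C(H,u)$ be a class of the partition $\Pi(2e,K)$, where $H$ is a hyperplane of $T$ and $u\in V'$ with $ru\notin H$. Then any two distinct vertices of $C(H,u)$ have $q^{4e-3}-q^{4e-4}-q^{2e-2}$ common neighbours in $Y(2e,K)$.
   Context: Let $e\geq 2$ and let $K$ be a finite commutative ring with identity having precisely three ideals $\{0\}$, $J=\langle r\rangle$, $K$, with $K/J\cong\mathbb{F}_q$ ($q$ a prime power). Let $K^\times$ be the set of units, $V'$ the set of tuples in $K^{2e}$ with at least one entry in $K^\times$, for $a\in V'$ let $[a]=\{\lambda a:\lambda\in K^\times\}$, and $V=\{[a]:a\in V'\}$. For $a,b\in K^{2e}$ let $\langle a,b\rangle=\sum_{i=1}^e(a_ib_{e+i}-a_{e+i}b_i)$. The graph $Y(2e,K)$ has vertex set $V$, $[a]\sim[b]$ iff $\langle a,b\rangle\in J\setminus\{0\}$. Let $T=J^{2e}$, a $2e$-dimensional vector space over $K/J$ with $(z+J)\cdot x=zx$; a hyperplane is a $(2e-1)$-dimensional subspace. For $u\in K^{2e}$, $ru\in T$ is the componentwise product. For a hyperplane $H$ and $u\in V'$ with $ru\notin H$, $C(H,u)=\{[u+h]:h\in H\}$; these sets form a partition of $V$, denoted $\Pi(2e,K)$. -}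

module Defs where

open import Level using (0ℓ)
open import Algebra.Bundles using (CommutativeRing)
open import Data.Nat as ℕ using (ℕ; zero; suc)
open import Data.Fin using (Fin; zero; suc; _↑ˡ_; _↑ʳ_)
import Data.Fin.Properties as FinP
open import Data.List using (List; []; _∷_; map; concatMap; filter; length; deduplicate)
open import Data.List.Relation.Unary.Any as Any using (Any; here; there)
open import Data.List.Relation.Unary.AllPairs using (AllPairs)
open import Data.Product using (Σ; ∃; _×_; _,_; proj₁; proj₂)
open import Data.Product.Properties using () 
open import Data.Sum using (_⊎_)
open import Relation.Nullary using (¬_; Dec; yes; no; ¬?)
open import Relation.Nullary.Decidable using (map′; _×-dec_)
open import Relation.Binary using (Decidable)
open import Data.Nat.Primality using (Prime)
open import Relation.Binary.PropositionalEquality using (_≡_)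
open import Function using (_⇔_)

record FiniteCommRing : Set₁ where
  field
    ring     : CommutativeRing 0ℓ 0ℓ
  open CommutativeRing ring public hiding (ring)
  field
    _≟_      : Decidable _≈_
    elems    : List Carrier
    complete : ∀ x → Any (x ≈_) elems
    distinct : AllPairs (λ a b → ¬ (a ≈ b)) elems

IsPrimePower : ℕ → Set
IsPrimePower q = Σ ℕ λ p → Σ ℕ λ k → Prime p × q ≡ p ℕ.^ suc k

module Over (F : FiniteCommRing) where
  open FiniteCommRing F hiding (zero)

  find? : (P : Carrier → Set) → (∀ {a b} → a ≈ b → P a → P b) →
          (∀ a → Dec (P a)) → Dec (∃ P)
  find? P resp P? = map′ to from (Any.any? P? elems)
    where
    to : Any P elems → ∃ P
    to a = Any.satisfied a
    from : ∃ P → Any P elems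
    from (x , px) = Any.map (λ {y} x≈y → resp x≈y px) (complete x)

  record IsIdeal (I : Carrier → Set) : Set where
    field
      resp  : ∀ {a b} → a ≈ b → I a → I b
      has0  : I 0#
      +-cl  : ∀ {a b} → I a → I b → I (a + b)
      *-cl  : ∀ s {a} → I a → I (s * a)

  ⟨_⟩ : Carrier → Carrier → Set
  ⟨ r ⟩ x = ∃ λ s → x ≈ s * r

  ExactlyThreeIdeals : Carrier → Set₁
  ExactlyThreeIdeals r =
      (¬ (r ≈ 0#))
    × (¬ ⟨ r ⟩ 1#)
    × (∀ (I : Carrier → Set) → IsIdeal I →
         (∀ x → I x ⇔ (x ≈ 0#)) ⊎ (∀ x → I x ⇔ ⟨ r ⟩ x) ⊎ (∀ x → I x))

  IsUnit : Carrier → Set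
  IsUnit x = ∃ λ y → x * y ≈ 1#

  IsUnit? : ∀ x → Dec (IsUnit x)
  IsUnit? x = find? (λ y → x * y ≈ 1#)
                    (λ a≈b p → trans (*-congˡ (sym a≈b)) p)
                    (λ y → (x * y) ≟ 1#)

  allTuples : (n : ℕ) → List (Fin n → Carrier)
  allTuples zero    = (λ ()) ∷ []
  allTuples (suc n) = concatMap (λ c → map (λ f → cons c f) (allTuples n)) elems
    where
    cons : Carrier → (Fin n → Carrier) → Fin (suc n) → Carrier
    cons c f zero    = c
    cons c f (suc i) = f i

  sumF : (n : ℕ) → (Fin n → Carrier) → Carrier
  sumF zero    f = 0#
  sumF (suc n) f = f zero + sumF n (λ i → f (suc i))

  #classes : {A : Set} {R : A → A → Set} → Decidable R → List A → ℕ
  #classes R? xs = length (deduplicate R? xs)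

  module WithJ (r : Carrier) where

    J : Carrier → Set
    J = ⟨ r ⟩

    J? : ∀ x → Dec (J x)
    J? x = find? (λ s → x ≈ s * r)
                 (λ a≈b p → trans p (*-congʳ a≈b))
                 (λ s → x ≟ (s * r))

    residueSize : ℕ
    residueSize = #classes (λ a b → J? (a - b)) elems

    module Dim (e : ℕ) where

      n : ℕ
      n = e ℕ.+ e

      Vec : Set
      Vec = Fin n → Carrier

      form : Vec → Vec → Carrier
      form a b = sumF e (λ i → a (i ↑ˡ e) * b (e ↑ʳ i) - a (e ↑ʳ i) * b (i ↑ˡ e))

      InV' : Vec → Set
      InV' a = ∃ λ i → IsUnit (a i)

      InV'? : ∀ a → Dec (InV' a)
      InV'? a = FinP.any? (λ i → IsUnit? (a i))

      -- [a] = [b]  :  b = λ a for a unit λ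
      _∼_ : Vec → Vec → Set
      a ∼ b = ∃ λ l → IsUnit l × (∀ i → b i ≈ l * a i)

      _∼?_ : Decidable _∼_
      a ∼? b = find? (λ l → IsUnit l × (∀ i → b i ≈ l * a i))
                     (λ { a≈b (u , p) →
                          (proj₁ u , trans (*-congʳ (sym a≈b)) (proj₂ u))
                        , (λ i → trans (p i) (*-congʳ a≈b)) })
                     (λ l → IsUnit? l ×-dec FinP.all? (λ i → b i ≟ (l * a i)))

      Adj : Vec → Vec → Set
      Adj a b = J (form a b) × ¬ (form a b ≈ 0#)

      Adj? : ∀ a b → Dec (Adj a b)
      Adj? a b = J? (form a b) ×-dec ¬? (form a b ≟ 0#)

      commonNeighbours : Vec → Vec → ℕ
      commonNeighbours x y =
        #classes _∼?_
          (filter (λ a → InV'? a ×-dec (Adj? a x ×-dec Adj? a y)) (allTuples n))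

      InT : Vec → Set
      InT v = ∀ i → J (v i)

      r·_ : Vec → Vec
      (r· u) i = r * u i

      -- family of k vectors of T, linearly independent over K/J
      -- (where (z + J)·x = z x)
      LinIndep : {k : ℕ} → (Fin k → Vec) → Set
      LinIndep {k} b = ∀ (c : Fin k → Carrier) →
        (∀ i → sumF k (λ j → c j * b j i) ≈ 0#) → ∀ j → J (c j)

      Span : {k : ℕ} → (Fin k → Vec) → Vec → Set
      Span {k} b v = ∃ λ (c : Fin k → Carrier) →
        ∀ i → v i ≈ sumF k (λ j → c j * b j i)

      record Hyperplane : Set where
        field
          basis    : Fin (n ℕ.∸ 1) → Vec
          basis∈T  : ∀ j → InT (basis j)
          indep    : LinIndep basis
        Mem : Vec → Set
        Mem = Span basis

      InC : Hyperplane → Vec → Vec → Set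
      InC H u x = InV' x × ∃ λ h → Hyperplane.Mem H h × ((λ i → u i + h i) ∼ x)

-- Write x = l(u + h) and y = l′(u + h′) with h, h′ ∈ H ⊆ J²ᵉ, so h′ − h = rδ. For a ∈ K²ᵉ,
-- ⟨a, x⟩ and ⟨a, y⟩ are unit multiples of X·a and X·a + r(E·a), where X = Ω(u + h), E = Ωδ and
-- ⟨a, b⟩ = Ωb·a. Since [x] ≠ [y] and ru ∉ H, X and E stay linearly independent modulo J, so
-- a ↦ (X·a, E·a mod J) is equidistributed on K × K/J, and on J²ᵉ the form a ↦ X·a is
-- equidistributed on J. Counting the tuples a with X·a and X·a + r(E·a) in J ∖ {0}, discarding
-- those in J²ᵉ and dividing by the size q² − q of a class [a] gives the result, using |J| = q,
-- |K| = q² and J² = 0.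

module Submission where

open import Defs
open import Level using (0ℓ)
open import Algebra.Bundles using (CommutativeRing)
open import Data.Nat as ℕ using (ℕ; zero; suc)
open import Data.Integer as ℤ using (ℤ)
open import Relation.Nullary using (¬_; yes; no)
open import Relation.Binary.PropositionalEquality as ≡ using (_≡_)

-- The reflective ring solver takes its coefficients from the ring itself, so it cannot see that
-- 1# - 1# is zero in an abstract ring; coefficients in ℤ, mapped into R, can be compared.
module ℤ-RingSolver (R : CommutativeRing 0ℓ 0ℓ) where
  open CommutativeRing R
  open import Algebra.Properties.Ring ring using (-0#≈0#; -‿+-comm; -‿distribˡ-*; -‿distribʳ-*; -‿involutive)
  open import Algebra.Properties.Semiring.Mult.TCOptimised semiring using (_×_; 1+×; ×-homo-+; ×1-homo-*)
  open import Algebra.Properties.CommutativeSemigroup +-commutativeSemigroup using (interchange)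
  open import Algebra.Solver.Ring.AlmostCommutativeRing using (fromCommutativeRing; _-Raw-AlmostCommutative⟶_)
  import Data.Integer.Properties as ℤ
  import Data.Nat.Properties as ℕ
  open import Data.Maybe using (Maybe; just; nothing)
  open import Data.Sign as Sign using (Sign)
  open import Relation.Binary.Reasoning.Setoid setoid

  ⟦_⟧ : ℤ → Carrier
  ⟦ ℤ.+ n ⟧ = n × 1#
  ⟦ ℤ.-[1+ n ] ⟧ = - (suc n × 1#)

  private
    ⊖-homo : ∀ m n → ⟦ m ℤ.⊖ n ⟧ ≈ m × 1# - n × 1#
    ⊖-homo m zero = sym (trans (+-congˡ -0#≈0#) (+-identityʳ _))
    ⊖-homo zero (suc n) = sym (+-identityˡ _)
    ⊖-homo (suc m) (suc n) = begin
      ⟦ suc m ℤ.⊖ suc n ⟧                  ≡⟨ ≡.cong ⟦_⟧ (ℤ.[1+m]⊖[1+n]≡m⊖n m n) ⟩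
      ⟦ m ℤ.⊖ n ⟧                          ≈⟨ ⊖-homo m n ⟩
      m × 1# - n × 1#                      ≈⟨ +-identityˡ _ ⟨
      0# + (m × 1# - n × 1#)               ≈⟨ +-congʳ (-‿inverseʳ 1#) ⟨
      (1# - 1#) + (m × 1# - n × 1#)        ≈⟨ interchange 1# (- 1#) (m × 1#) (- (n × 1#)) ⟩
      (1# + m × 1#) + (- 1# - n × 1#)      ≈⟨ +-cong (1+× m 1#) (trans (-‿cong (1+× n 1#)) (sym (-‿+-comm 1# (n × 1#)))) ⟨
      suc m × 1# - suc n × 1#              ∎

    sign : Sign → Carrier → Carrier
    sign Sign.+ x = x
    sign Sign.- x = - x

    sign-cong : ∀ s {a b} → a ≈ b → sign s a ≈ sign s b
    sign-cong Sign.+ a≈b = a≈b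
    sign-cong Sign.- a≈b = -‿cong a≈b

    sign-* : ∀ s t a b → sign (s Sign.* t) (a * b) ≈ sign s a * sign t b
    sign-* Sign.+ Sign.+ a b = refl
    sign-* Sign.+ Sign.- a b = -‿distribʳ-* a b
    sign-* Sign.- Sign.+ a b = -‿distribˡ-* a b
    sign-* Sign.- Sign.- a b = begin
      a * b           ≈⟨ -‿involutive _ ⟨
      - - (a * b)     ≈⟨ -‿cong (-‿distribʳ-* a b) ⟩
      - (a * - b)     ≈⟨ -‿distribˡ-* a (- b) ⟩
      - a * - b       ∎

    ⟦⟧-sign : ∀ i → ⟦ i ⟧ ≈ sign (ℤ.sign i) (ℤ.∣ i ∣ × 1#)
    ⟦⟧-sign (ℤ.+ n) = refl
    ⟦⟧-sign ℤ.-[1+ n ] = refl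

    ⟦⟧-◃ : ∀ s n → ⟦ s ℤ.◃ n ⟧ ≈ sign s (n × 1#)
    ⟦⟧-◃ Sign.- zero = sym -0#≈0#
    ⟦⟧-◃ Sign.+ zero = refl
    ⟦⟧-◃ Sign.+ (suc n) = refl
    ⟦⟧-◃ Sign.- (suc n) = refl

    +-homo : ∀ i j → ⟦ i ℤ.+ j ⟧ ≈ ⟦ i ⟧ + ⟦ j ⟧
    +-homo (ℤ.+ m) (ℤ.+ n) = ×-homo-+ 1# m n
    +-homo (ℤ.+ m) ℤ.-[1+ n ] = ⊖-homo m (suc n)
    +-homo ℤ.-[1+ m ] (ℤ.+ n) = trans (⊖-homo n (suc m)) (+-comm _ _)
    +-homo ℤ.-[1+ m ] ℤ.-[1+ n ] = begin
      - (suc (suc (m ℕ.+ n)) × 1#)         ≡⟨ ≡.cong (λ k → - (suc k × 1#)) (ℕ.+-suc m n) ⟨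
      - ((suc m ℕ.+ suc n) × 1#)           ≈⟨ -‿cong (×-homo-+ 1# (suc m) (suc n)) ⟩
      - (suc m × 1# + suc n × 1#)          ≈⟨ -‿+-comm _ _ ⟨
      ⟦ ℤ.-[1+ m ] ⟧ + ⟦ ℤ.-[1+ n ] ⟧      ∎

    *-homo : ∀ i j → ⟦ i ℤ.* j ⟧ ≈ ⟦ i ⟧ * ⟦ j ⟧
    *-homo i j = begin
      ⟦ (s Sign.* t) ℤ.◃ (m ℕ.* n) ⟧       ≈⟨ ⟦⟧-◃ (s Sign.* t) (m ℕ.* n) ⟩
      sign (s Sign.* t) ((m ℕ.* n) × 1#)   ≈⟨ sign-cong (s Sign.* t) (×1-homo-* m n) ⟩
      sign (s Sign.* t) (m × 1# * n × 1#)  ≈⟨ sign-* s t _ _ ⟩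
      sign s (m × 1#) * sign t (n × 1#)    ≈⟨ *-cong (⟦⟧-sign i) (⟦⟧-sign j) ⟨
      ⟦ i ⟧ * ⟦ j ⟧                        ∎
      where
      s t : Sign
      s = ℤ.sign i
      t = ℤ.sign j
      m n : ℕ
      m = ℤ.∣ i ∣
      n = ℤ.∣ j ∣

    -‿homo : ∀ i → ⟦ ℤ.- i ⟧ ≈ - ⟦ i ⟧
    -‿homo (ℤ.+ zero) = sym -0#≈0#
    -‿homo (ℤ.+ suc n) = refl
    -‿homo ℤ.-[1+ n ] = sym (-‿involutive _)

    homomorphism : ℤ.+-*-rawRing -Raw-AlmostCommutative⟶ fromCommutativeRing R
    homomorphism = record
      { ⟦_⟧ = ⟦_⟧ ; +-homo = +-homo ; *-homo = *-homo ; -‿homo = -‿homo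
      ; 0-homo = refl ; 1-homo = refl }

    coefficient≟ : ∀ i j → Maybe (⟦ i ⟧ ≈ ⟦ j ⟧)
    coefficient≟ i j with i ℤ.≟ j
    ... | yes ≡.refl = just refl
    ... | no _ = nothing

  open import Algebra.Solver.Ring ℤ.+-*-rawRing (fromCommutativeRing R) homomorphism coefficient≟ public
    using (solve; _:=_; _:+_; _:*_; :-_; _:-_; con)

module ListSum where
  open import Data.List using (List; []; _∷_; _++_; map; concatMap; filter; length; deduplicate)
  open import Data.List.Relation.Unary.All as All using (All; []; _∷_)
  open import Data.List.Relation.Unary.Any as Any using (Any; here; there)
  open import Data.List.Relation.Unary.AllPairs as AllPairs using (AllPairs; []; _∷_)
  import Data.List.Relation.Unary.All.Properties as All
  import Data.List.Relation.Unary.Any.Properties as Any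
  open import Data.List.Relation.Unary.Unique.DecSetoid.Properties using (deduplicate-!)
  open import Data.Nat using (_+_; _*_)
  open import Data.Nat.Properties using (m+n≡0⇒n≡0; +-assoc; +-identityʳ; *-identityʳ; *-zeroʳ; *-comm; *-distribˡ-+; +-commutativeSemigroup)
  open import Algebra.Properties.CommutativeSemigroup +-commutativeSemigroup using () renaming (interchange to +-interchange)
  open import Data.Product using (_×_; _,_; proj₁; proj₂)
  open import Data.Empty using (⊥-elim)
  open import Function using (_∘_)
  open import Relation.Nullary using (Dec)
  open import Relation.Binary.Bundles using (DecSetoid)
  open import Data.List.Membership.Propositional using (_∈_)
  open ≡ using (_≢_; refl; cong; cong₂; sym; trans)
  open ≡.≡-Reasoning

  𝟙 : ∀ {p} {P : Set p} → Dec P → ℕ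
  𝟙 (yes _) = 1
  𝟙 (no _) = 0

  𝟙-yes : ∀ {p} {P : Set p} (dp : Dec P) → P → 𝟙 dp ≡ 1
  𝟙-yes (yes _) _ = refl
  𝟙-yes (no ¬p) p = ⊥-elim (¬p p)

  𝟙-no : ∀ {p} {P : Set p} (dp : Dec P) → ¬ P → 𝟙 dp ≡ 0
  𝟙-no (yes p) ¬p = ⊥-elim (¬p p)
  𝟙-no (no _) _ = refl

  𝟙-idem : ∀ {p} {P : Set p} (dp : Dec P) → 𝟙 dp * 𝟙 dp ≡ 𝟙 dp
  𝟙-idem (yes _) = refl
  𝟙-idem (no _) = refl

  module _ {p q} {P : Set p} {Q : Set q} where

    𝟙-cong : (dp : Dec P) (dq : Dec Q) → (P → Q) → (Q → P) → 𝟙 dp ≡ 𝟙 dq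
    𝟙-cong (yes _) (yes _) _ _ = refl
    𝟙-cong (yes p) (no ¬q) f _ = ⊥-elim (¬q (f p))
    𝟙-cong (no ¬p) (yes q) _ g = ⊥-elim (¬p (g q))
    𝟙-cong (no _) (no _) _ _ = refl

    𝟙-× : (dp : Dec P) (dq : Dec Q) (dpq : Dec (P × Q)) → 𝟙 dpq ≡ 𝟙 dp * 𝟙 dq
    𝟙-× (yes p) (yes q) dpq = 𝟙-yes dpq (p , q)
    𝟙-× (yes _) (no ¬q) dpq = 𝟙-no dpq (¬q ∘ proj₂)
    𝟙-× (no ¬p) _ dpq = 𝟙-no dpq (¬p ∘ proj₁)

  𝟙*-cong : ∀ {p} {P : Set p} (dp : Dec P) {x y} → (P → x ≡ y) → 𝟙 dp * x ≡ 𝟙 dp * y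
  𝟙*-cong (yes p) x≡y = cong (1 *_) (x≡y p)
  𝟙*-cong (no _) _ = refl

  𝟙-*-implied : ∀ {p q} {P : Set p} {Q : Set q} (dp : Dec P) (dq : Dec Q) → (P → Q) → 𝟙 dq * 𝟙 dp ≡ 𝟙 dp
  𝟙-*-implied (yes p) dq P⇒Q = cong (_* 1) (𝟙-yes dq (P⇒Q p))
  𝟙-*-implied (no _) dq _ = *-zeroʳ (𝟙 dq)

  𝟙-¬ : ∀ {p} {P : Set p} (dp : Dec P) (d¬p : Dec (¬ P)) → 𝟙 dp + 𝟙 d¬p ≡ 1
  𝟙-¬ (yes p) d¬p = cong suc (𝟙-no d¬p (λ ¬p → ¬p p))
  𝟙-¬ (no ¬p) d¬p = 𝟙-yes d¬p ¬p

  module _ {a} {A : Set a} where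

    ∑ : List A → (A → ℕ) → ℕ
    ∑ [] f = 0
    ∑ (x ∷ xs) f = f x + ∑ xs f

    syntax ∑ xs (λ x → e) = ∑[ x ∈ xs ] e

    ∑-cong : ∀ xs {f g : A → ℕ} → (∀ x → f x ≡ g x) → ∑ xs f ≡ ∑ xs g
    ∑-cong [] f≗g = refl
    ∑-cong (x ∷ xs) f≗g = cong₂ _+_ (f≗g x) (∑-cong xs f≗g)

    ∑-cong-All : ∀ {p} {P : A → Set p} {xs} {f g : A → ℕ} →
                 All P xs → (∀ {x} → P x → f x ≡ g x) → ∑ xs f ≡ ∑ xs g
    ∑-cong-All [] f≗g = refl
    ∑-cong-All (px ∷ pxs) f≗g = cong₂ _+_ (f≗g px) (∑-cong-All pxs f≗g)

    ∑-distrib-+ : ∀ xs (f g : A → ℕ) → ∑[ x ∈ xs ] (f x + g x) ≡ ∑ xs f + ∑ xs g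
    ∑-distrib-+ [] f g = refl
    ∑-distrib-+ (x ∷ xs) f g =
      trans (cong (f x + g x +_) (∑-distrib-+ xs f g)) (+-interchange (f x) (g x) _ _)

    *-distribˡ-∑ : ∀ c xs (f : A → ℕ) → c * ∑ xs f ≡ ∑[ x ∈ xs ] (c * f x)
    *-distribˡ-∑ c [] f = *-zeroʳ c
    *-distribˡ-∑ c (x ∷ xs) f = trans (*-distribˡ-+ c (f x) _) (cong (c * f x +_) (*-distribˡ-∑ c xs f))

    *-distribʳ-∑ : ∀ c xs (f : A → ℕ) → ∑ xs f * c ≡ ∑[ x ∈ xs ] (f x * c)
    *-distribʳ-∑ c xs f = trans (*-comm (∑ xs f) c)
                            (trans (*-distribˡ-∑ c xs f) (∑-cong xs (λ x → *-comm c (f x))))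

    ∑-const : ∀ xs c → ∑[ x ∈ xs ] c ≡ length xs * c
    ∑-const [] c = refl
    ∑-const (x ∷ xs) c = cong (c +_) (∑-const xs c)

    ∑-++ : ∀ xs ys (f : A → ℕ) → ∑ (xs ++ ys) f ≡ ∑ xs f + ∑ ys f
    ∑-++ [] ys f = refl
    ∑-++ (x ∷ xs) ys f = trans (cong (f x +_) (∑-++ xs ys f)) (sym (+-assoc (f x) _ _))

    ∑-filter : ∀ {p} {P : A → Set p} (P? : ∀ x → Dec (P x)) xs (f : A → ℕ) →
               ∑ (filter P? xs) f ≡ ∑[ x ∈ xs ] (𝟙 (P? x) * f x)
    ∑-filter P? [] f = refl
    ∑-filter P? (x ∷ xs) f with P? x
    ... | yes _ = cong₂ _+_ (sym (+-identityʳ (f x))) (∑-filter P? xs f)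
    ... | no _ = ∑-filter P? xs f

    length-filter : ∀ {p} {P : A → Set p} (P? : ∀ x → Dec (P x)) xs →
                    length (filter P? xs) ≡ ∑[ x ∈ xs ] 𝟙 (P? x)
    length-filter P? xs = begin
      length (filter P? xs)            ≡⟨ *-identityʳ _ ⟨
      length (filter P? xs) * 1        ≡⟨ ∑-const (filter P? xs) 1 ⟨
      ∑[ x ∈ filter P? xs ] 1          ≡⟨ ∑-filter P? xs (λ _ → 1) ⟩
      ∑[ x ∈ xs ] (𝟙 (P? x) * 1)       ≡⟨ ∑-cong xs (λ x → *-identityʳ _) ⟩
      ∑[ x ∈ xs ] 𝟙 (P? x)             ∎

    ∑-𝟙-none : ∀ {q} {Q : A → Set q} (Q? : ∀ x → Dec (Q x)) xs → (∀ x → ¬ Q x) → ∑[ x ∈ xs ] 𝟙 (Q? x) ≡ 0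
    ∑-𝟙-none Q? [] ¬Q = refl
    ∑-𝟙-none Q? (x ∷ xs) ¬Q = cong₂ _+_ (𝟙-no (Q? x) (¬Q x)) (∑-𝟙-none Q? xs ¬Q)

    ∑-𝟙-unique : ∀ {q} {Q : A → Set q} (Q? : ∀ x → Dec (Q x)) {xs} →
                 AllPairs (λ a b → ¬ (Q a × Q b)) xs → Any Q xs → ∑[ x ∈ xs ] 𝟙 (Q? x) ≡ 1
    ∑-𝟙-unique Q? {x ∷ xs} (¬QxQ ∷ _) (here qx) = begin
      𝟙 (Q? x) + ∑[ y ∈ xs ] 𝟙 (Q? y) ≡⟨ cong₂ _+_ (𝟙-yes (Q? x) qx) (∑-cong-All ¬QxQ (λ ¬qq → 𝟙-no (Q? _) (λ qy → ¬qq (qx , qy)))) ⟩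
      1 + ∑[ y ∈ xs ] 0               ≡⟨ cong suc (trans (∑-const xs 0) (*-zeroʳ (length xs))) ⟩
      1                               ∎
    ∑-𝟙-unique Q? {x ∷ xs} (¬QxQ ∷ unique) (there any) =
      cong₂ _+_ (𝟙-no (Q? x) (λ qx → All.lookupWith (λ ¬qq qy → ¬qq (qx , qy)) ¬QxQ any)) (∑-𝟙-unique Q? unique any)

  ∑-𝟙-≢0 : ∀ {a q} {A : Set a} {Q : A → Set q} (Q? : ∀ x → Dec (Q x)) {xs} → Any Q xs → ∑[ x ∈ xs ] 𝟙 (Q? x) ≢ 0
  ∑-𝟙-≢0 Q? {x ∷ _} (here qx) with Q? x
  ... | yes _ = λ ()
  ... | no ¬qx = ⊥-elim (¬qx qx)
  ∑-𝟙-≢0 Q? {x ∷ _} (there any) ∑≡0 = ∑-𝟙-≢0 Q? any (m+n≡0⇒n≡0 (𝟙 (Q? x)) ∑≡0)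

  ∑-map : ∀ {a b} {A : Set a} {B : Set b} (g : A → B) xs (f : B → ℕ) → ∑ (map g xs) f ≡ ∑[ x ∈ xs ] f (g x)
  ∑-map g [] f = refl
  ∑-map g (x ∷ xs) f = cong (f (g x) +_) (∑-map g xs f)

  ∑-concatMap : ∀ {a b} {A : Set a} {B : Set b} (g : A → List B) xs (f : B → ℕ) →
                ∑ (concatMap g xs) f ≡ ∑[ x ∈ xs ] ∑ (g x) f
  ∑-concatMap g [] f = refl
  ∑-concatMap g (x ∷ xs) f = trans (∑-++ (g x) (concatMap g xs) f) (cong (∑ (g x) f +_) (∑-concatMap g xs f))

  ∑-comm : ∀ {a b} {A : Set a} {B : Set b} xs ys (f : A → B → ℕ) →
           ∑[ x ∈ xs ] ∑[ y ∈ ys ] f x y ≡ ∑[ y ∈ ys ] ∑[ x ∈ xs ] f x y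
  ∑-comm [] ys f = sym (trans (∑-const ys 0) (*-zeroʳ (length ys)))
  ∑-comm (x ∷ xs) ys f = begin
    ∑ ys (f x) + ∑[ x ∈ xs ] ∑[ y ∈ ys ] f x y  ≡⟨ cong (∑ ys (f x) +_) (∑-comm xs ys f) ⟩
    ∑ ys (f x) + ∑[ y ∈ ys ] ∑[ x ∈ xs ] f x y  ≡⟨ ∑-distrib-+ ys (f x) _ ⟨
    ∑[ y ∈ ys ] (f x y + ∑[ x ∈ xs ] f x y)     ∎

  module Classes {c ℓ} (D : DecSetoid c ℓ) where
    open DecSetoid D using (Carrier; _≈_; _≟_) renaming (sym to ≈-sym; trans to ≈-trans)

    length≡*#classes : ∀ xs k → All (λ y → ∑[ z ∈ xs ] 𝟙 (y ≟ z) ≡ k) xs →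
                       length xs ≡ k * length (deduplicate _≟_ xs)
    length≡*#classes xs k classSize = begin
      length xs                                 ≡⟨ *-identityʳ _ ⟨
      length xs * 1                             ≡⟨ ∑-const xs 1 ⟨
      ∑[ z ∈ xs ] 1                             ≡⟨ ∑-cong-All (All.tabulate (λ z∈xs → z∈xs)) (λ z∈xs → sym (oneRepresentative z∈xs)) ⟩
      ∑[ z ∈ xs ] ∑[ y ∈ ds ] 𝟙 (y ≟ z)         ≡⟨ ∑-comm xs ds _ ⟩
      ∑[ y ∈ ds ] ∑[ z ∈ xs ] 𝟙 (y ≟ z)         ≡⟨ ∑-cong-All (All.deduplicate⁺ _≟_ classSize) (λ eq → eq) ⟩
      ∑[ y ∈ ds ] k                             ≡⟨ ∑-const ds k ⟩
      length ds * k                             ≡⟨ *-comm (length ds) k ⟩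
      k * length ds                             ∎
      where
      ds : List Carrier
      ds = deduplicate _≟_ xs
      oneRepresentative : ∀ {z} → z ∈ xs → ∑[ y ∈ ds ] 𝟙 (y ≟ z) ≡ 1
      oneRepresentative z∈xs = ∑-𝟙-unique (_≟ _)
        (AllPairs.map (λ ¬x≈y (x≈z , y≈z) → ¬x≈y (≈-trans x≈z (≈-sym y≈z))) (deduplicate-! D xs))
        (Any.deduplicate⁺ _≟_ (λ y≈x x≈z → ≈-trans y≈x x≈z) (Any.map (λ { ≡.refl → DecSetoid.refl D }) z∈xs))

module Units (F : FiniteCommRing) where
  open FiniteCommRing F hiding (zero)
  open Over F
  open ℤ-RingSolver ring using (solve; _:=_; _:*_; :-_)
  open import Relation.Binary.Reasoning.Setoid setoid
  open import Data.Product using (_,_; proj₁)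

  uv≈1⇒v[ua]≈a : ∀ {u v} → u * v ≈ 1# → ∀ a → v * (u * a) ≈ a
  uv≈1⇒v[ua]≈a {u} {v} uv≈1 a = begin
    v * (u * a)   ≈⟨ solve 3 (λ u v a → v :* (u :* a) := (u :* v) :* a) refl u v a ⟩
    (u * v) * a   ≈⟨ *-congʳ uv≈1 ⟩
    1# * a        ≈⟨ *-identityˡ a ⟩
    a             ∎

  uv≈1⇒u[va]≈a : ∀ {u v} → u * v ≈ 1# → ∀ a → u * (v * a) ≈ a
  uv≈1⇒u[va]≈a {u} {v} uv≈1 = uv≈1⇒v[ua]≈a (trans (*-comm v u) uv≈1)

  unit-cancelˡ : ∀ {u a b} → IsUnit u → u * a ≈ u * b → a ≈ b
  unit-cancelˡ {u} {a} {b} (v , uv≈1) ua≈ub =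
    trans (sym (uv≈1⇒v[ua]≈a uv≈1 a)) (trans (*-congˡ ua≈ub) (uv≈1⇒v[ua]≈a uv≈1 b))

  unit-1 : IsUnit 1#
  unit-1 = 1# , *-identityˡ 1#

  unit-* : ∀ {a b} → IsUnit a → IsUnit b → IsUnit (a * b)
  unit-* {a} {b} (a⁻¹ , aa⁻¹≈1) (b⁻¹ , bb⁻¹≈1) = b⁻¹ * a⁻¹ , (begin
    a * b * (b⁻¹ * a⁻¹)   ≈⟨ solve 4 (λ a b c d → a :* b :* (c :* d) := (a :* d) :* (b :* c)) refl a b b⁻¹ a⁻¹ ⟩
    (a * a⁻¹) * (b * b⁻¹) ≈⟨ *-cong aa⁻¹≈1 bb⁻¹≈1 ⟩
    1# * 1#               ≈⟨ *-identityˡ 1# ⟩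
    1#                    ∎)

  unit-inverse : ∀ {a} → (unit : IsUnit a) → IsUnit (proj₁ unit)
  unit-inverse {a} (b , ab≈1) = a , trans (*-comm b a) ab≈1

  unit-resp : ∀ {a b} → a ≈ b → IsUnit a → IsUnit b
  unit-resp a≈b (c , ac≈1) = c , trans (*-congʳ (sym a≈b)) ac≈1

  unit-neg : ∀ {a} → IsUnit a → IsUnit (- a)
  unit-neg {a} (b , ab≈1) = - b , trans (solve 2 (λ a b → (:- a) :* (:- b) := a :* b) refl a b) ab≈1

module ElementSums (F : FiniteCommRing) where
  open FiniteCommRing F hiding (zero)
  open Over F
  open Units F
  open ℤ-RingSolver ring using (solve; _:=_; _:+_; _:*_; _:-_)
  open ListSum
  import Data.List.Relation.Unary.Any as Any
  import Data.List.Relation.Unary.AllPairs as AllPairs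
  open import Data.Nat using () renaming (_*_ to _*ℕ_)
  import Data.Nat.Properties as ℕ
  open import Data.Product using (_,_)
  open import Relation.Nullary using (Dec)
  open import Relation.Binary.Core using (_Preserves_⟶_)
  open ≡.≡-Reasoning

  ∑-unique : ∀ {q} {Q : Carrier → Set q} (Q? : ∀ x → Dec (Q x)) → (∀ {a b} → a ≈ b → Q a → Q b) →
             (∀ {a b} → Q a → Q b → a ≈ b) → ∀ {a} → Q a → ∑[ k ∈ elems ] 𝟙 (Q? k) ≡ 1
  ∑-unique Q? resp unique {a} qa = ∑-𝟙-unique Q?
    (AllPairs.map (λ k≉l (qk , ql) → k≉l (unique qk ql)) distinct)
    (Any.map (λ a≈k → resp a≈k qa) (complete a))

  ∑-δ : ∀ a → ∑[ k ∈ elems ] 𝟙 (k ≟ a) ≡ 1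
  ∑-δ a = ∑-unique (_≟ a) (λ k≈l k≈a → trans (sym k≈l) k≈a) (λ k≈a l≈a → trans k≈a (sym l≈a)) refl

  ∑-sift : ∀ {φ : Carrier → ℕ} → φ Preserves _≈_ ⟶ _≡_ → ∀ a → ∑[ k ∈ elems ] (𝟙 (k ≟ a) *ℕ φ k) ≡ φ a
  ∑-sift {φ} φ-resp a = begin
    ∑[ k ∈ elems ] (𝟙 (k ≟ a) *ℕ φ k) ≡⟨ ∑-cong elems pointwise ⟩
    ∑[ k ∈ elems ] (𝟙 (k ≟ a) *ℕ φ a) ≡⟨ *-distribʳ-∑ (φ a) elems (λ k → 𝟙 (k ≟ a)) ⟨
    ∑[ k ∈ elems ] 𝟙 (k ≟ a) *ℕ φ a   ≡⟨ ≡.cong (_*ℕ φ a) (∑-δ a) ⟩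
    1 *ℕ φ a                          ≡⟨ ℕ.*-identityˡ (φ a) ⟩
    φ a                               ∎
    where
    pointwise : ∀ k → 𝟙 (k ≟ a) *ℕ φ k ≡ 𝟙 (k ≟ a) *ℕ φ a
    pointwise k with k ≟ a
    ... | yes k≈a = ≡.cong (1 *ℕ_) (φ-resp k≈a)
    ... | no _ = ≡.refl

  ∣K×∣ : ℕ
  ∣K×∣ = ∑[ k ∈ elems ] 𝟙 (IsUnit? k)

  ∑-bijection : ∀ {σ τ : Carrier → Carrier} → σ Preserves _≈_ ⟶ _≈_ → τ Preserves _≈_ ⟶ _≈_ →
                (∀ k → τ (σ k) ≈ k) → (∀ m → σ (τ m) ≈ m) →
                ∀ {φ : Carrier → ℕ} → φ Preserves _≈_ ⟶ _≡_ → ∑[ k ∈ elems ] φ (σ k) ≡ ∑ elems φ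
  ∑-bijection {σ} {τ} σ-cong τ-cong τσ≈id στ≈id {φ} φ-resp = begin
    ∑[ k ∈ elems ] φ (σ k)                               ≡⟨ ∑-cong elems (λ k → ∑-sift φ-resp (σ k)) ⟨
    ∑[ k ∈ elems ] ∑[ m ∈ elems ] (𝟙 (m ≟ σ k) *ℕ φ m)   ≡⟨ ∑-comm elems elems _ ⟩
    ∑[ m ∈ elems ] ∑[ k ∈ elems ] (𝟙 (m ≟ σ k) *ℕ φ m)   ≡⟨ ∑-cong elems (λ m → *-distribʳ-∑ (φ m) elems _) ⟨
    ∑[ m ∈ elems ] (∑[ k ∈ elems ] 𝟙 (m ≟ σ k) *ℕ φ m)   ≡⟨ ∑-cong elems (λ m → ≡.cong (_*ℕ φ m) (oneSolution m)) ⟩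
    ∑[ m ∈ elems ] (1 *ℕ φ m)                            ≡⟨ ∑-cong elems (λ m → ℕ.*-identityˡ (φ m)) ⟩
    ∑ elems φ                                            ∎
    where
    oneSolution : ∀ m → ∑[ k ∈ elems ] 𝟙 (m ≟ σ k) ≡ 1
    oneSolution m = ∑-unique (λ k → m ≟ σ k) (λ k≈l m≈σk → trans m≈σk (σ-cong k≈l))
      (λ {k} {l} m≈σk m≈σl → trans (sym (τσ≈id k)) (trans (τ-cong (trans (sym m≈σk) m≈σl)) (τσ≈id l)))
      (sym (στ≈id m))

  ∑-affine : ∀ t {u} → IsUnit u → ∀ {φ : Carrier → ℕ} → φ Preserves _≈_ ⟶ _≡_ →
             ∑[ k ∈ elems ] φ (t + u * k) ≡ ∑ elems φ
  ∑-affine t {u} (v , uv≈1) = ∑-bijection (λ k≈l → +-congˡ (*-congˡ k≈l)) (λ m≈n → *-congˡ (+-congʳ m≈n))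
    (λ k → trans (*-congˡ (solve 3 (λ t u k → (t :+ u :* k) :- t := u :* k) refl t u k)) (uv≈1⇒v[ua]≈a uv≈1 k))
    (λ m → trans (+-congˡ (uv≈1⇒u[va]≈a uv≈1 (m - t))) (solve 2 (λ t m → t :+ (m :- t) := m) refl t m))

  ∑-translate : ∀ t {φ : Carrier → ℕ} → φ Preserves _≈_ ⟶ _≡_ → ∑[ k ∈ elems ] φ (t + k) ≡ ∑ elems φ
  ∑-translate t φ-resp = ≡.trans (∑-cong elems (λ k → φ-resp (+-congˡ (sym (*-identityˡ k))))) (∑-affine t unit-1 φ-resp)

module DotProduct (F : FiniteCommRing) where
  open FiniteCommRing F hiding (zero)
  open Over F
  open ℤ-RingSolver ring using (solve; _:=_; _:+_; _:*_)
  open import Data.Fin using (Fin; zero; suc; _↑ˡ_; _↑ʳ_)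
  open import Function using (_∘_)
  open import Relation.Binary.Reasoning.Setoid setoid

  Tuple : ℕ → Set
  Tuple m = Fin m → Carrier

  _·_ : ∀ {m} → Tuple m → Tuple m → Carrier
  _·_ {m} c a = sumF m (λ i → c i * a i)

  sumF-cong : ∀ m {f g : Tuple m} → (∀ i → f i ≈ g i) → sumF m f ≈ sumF m g
  sumF-cong zero f≈g = refl
  sumF-cong (suc m) f≈g = +-cong (f≈g zero) (sumF-cong m (λ i → f≈g (suc i)))

  sumF-+ : ∀ m (f g : Tuple m) → sumF m (λ i → f i + g i) ≈ sumF m f + sumF m g
  sumF-+ zero f g = sym (+-identityʳ 0#)
  sumF-+ (suc m) f g = trans (+-congˡ (sumF-+ m (λ i → f (suc i)) (λ i → g (suc i))))
    (solve 4 (λ a b c d → (a :+ b) :+ (c :+ d) := (a :+ c) :+ (b :+ d)) refl (f zero) (g zero) _ _)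

  sumF-* : ∀ m k (f : Tuple m) → sumF m (λ i → k * f i) ≈ k * sumF m f
  sumF-* zero k f = sym (zeroʳ k)
  sumF-* (suc m) k f = trans (+-congˡ (sumF-* m k (λ i → f (suc i)))) (sym (distribˡ k _ _))

  ·-cong : ∀ {m} {c c′ a a′ : Tuple m} → (∀ i → c i ≈ c′ i) → (∀ i → a i ≈ a′ i) → c · a ≈ c′ · a′
  ·-cong {m} c≈c′ a≈a′ = sumF-cong m (λ i → *-cong (c≈c′ i) (a≈a′ i))

  ·-scaleˡ : ∀ {m} k (c a : Tuple m) → (λ i → k * c i) · a ≈ k * (c · a)
  ·-scaleˡ {m} k c a = trans (sumF-cong m (λ i → *-assoc k (c i) (a i))) (sumF-* m k _)

  ·-scaleʳ : ∀ {m} k (c a : Tuple m) → c · (λ i → k * a i) ≈ k * (c · a)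
  ·-scaleʳ {m} k c a = trans (sumF-cong m (λ i → solve 3 (λ c k a → c :* (k :* a) := k :* (c :* a)) refl (c i) k (a i)))
                              (sumF-* m k _)

  ·-linearˡ : ∀ {m} (c d : Tuple m) k (a : Tuple m) → (λ i → c i + k * d i) · a ≈ c · a + k * (d · a)
  ·-linearˡ {m} c d k a = begin
    (λ i → c i + k * d i) · a                  ≈⟨ sumF-cong m (λ i → distribʳ (a i) (c i) (k * d i)) ⟩
    sumF m (λ i → c i * a i + k * d i * a i)    ≈⟨ sumF-+ m _ _ ⟩
    c · a + (λ i → k * d i) · a                 ≈⟨ +-congˡ (·-scaleˡ k d a) ⟩
    c · a + k * (d · a)                         ∎

  sumF-split : ∀ k l (f : Tuple (k ℕ.+ l)) → sumF (k ℕ.+ l) f ≈ sumF k (f ∘ (_↑ˡ l)) + sumF l (f ∘ (k ↑ʳ_))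
  sumF-split zero l f = sym (+-identityˡ _)
  sumF-split (suc k) l f = trans (+-congˡ (sumF-split k l (f ∘ suc))) (sym (+-assoc _ _ _))

module TupleSums (F : FiniteCommRing) where
  open FiniteCommRing F hiding (zero)
  open Over F
  open ElementSums F
  open DotProduct F
  open ListSum
  open ℤ-RingSolver ring using (solve; _:=_; _:+_)
  open import Data.List using (map; concatMap; length)
  open import Data.Fin using (Fin; zero; suc)
  open import Data.Fin.Properties using (all?; ∀-cons-⇔; ∃-toSum)
  open import Data.Nat using (_^_) renaming (_*_ to _*ℕ_)
  import Data.Nat.Properties as ℕ
  open import Data.Product using (∃; _,_; _×_)
  open import Data.Sum using (inj₁; inj₂)
  open import Function using (_∘_; Equivalence; _⇔_)
  open import Relation.Nullary using (Dec)
  open import Relation.Nullary.Decidable using (_×-dec_)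
  open import Relation.Binary.Core using (_Preserves_⟶_)
  open ≡.≡-Reasoning

  ∣K∣ : ℕ
  ∣K∣ = length elems

  -- allTuples (suc m) unfolds to the left-hand side, cons being the prepend function local to
  -- Defs.allTuples, which cannot be named here.
  ∑-allTuples-suc : ∀ {m} {cons : Carrier → Tuple m → Tuple (suc m)} (φ : Tuple (suc m) → ℕ) →
                    ∑ (concatMap (λ k → map (cons k) (allTuples m)) elems) φ ≡
                    ∑[ k ∈ elems ] ∑[ a ∈ allTuples m ] φ (cons k a)
  ∑-allTuples-suc {m} {cons} φ = ≡.trans (∑-concatMap (λ k → map (cons k) (allTuples m)) elems φ)
                                          (∑-cong elems (λ k → ∑-map (cons k) (allTuples m) φ))

  ∑-allTuples-const : ∀ m c → ∑[ a ∈ allTuples m ] c ≡ ∣K∣ ^ m *ℕ c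
  ∑-allTuples-const zero c = ≡.refl
  ∑-allTuples-const (suc m) c = begin
    ∑[ a ∈ allTuples (suc m) ] c             ≡⟨ ∑-allTuples-suc (λ _ → c) ⟩
    ∑[ k ∈ elems ] ∑[ a ∈ allTuples m ] c    ≡⟨ ∑-cong elems (λ _ → ∑-allTuples-const m c) ⟩
    ∑[ k ∈ elems ] (∣K∣ ^ m *ℕ c)            ≡⟨ ∑-const elems _ ⟩
    ∣K∣ *ℕ (∣K∣ ^ m *ℕ c)                    ≡⟨ ℕ.*-assoc ∣K∣ _ c ⟨
    ∣K∣ ^ suc m *ℕ c                         ∎

  𝟙-all?-suc : ∀ {m p} {P : Fin (suc m) → Set p} (P? : ∀ i → Dec (P i)) →
               𝟙 (all? P?) ≡ 𝟙 (P? zero) *ℕ 𝟙 (all? (P? ∘ suc))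
  𝟙-all?-suc P? = ≡.trans (𝟙-cong (all? P?) (P? zero ×-dec all? (P? ∘ suc)) (Equivalence.from ∀-cons-⇔) (Equivalence.to ∀-cons-⇔))
                          (𝟙-× (P? zero) (all? (P? ∘ suc)) _)

  ∑-allTuples-all? : ∀ m {p} {P : Fin m → Carrier → Set p} (P? : ∀ i x → Dec (P i x)) {c} →
                     (∀ i → ∑[ k ∈ elems ] 𝟙 (P? i k) ≡ c) → ∑[ a ∈ allTuples m ] 𝟙 (all? (λ i → P? i (a i))) ≡ c ^ m
  ∑-allTuples-all? zero P? count = ≡.refl
  ∑-allTuples-all? (suc m) P? {c} count = begin
    ∑[ a ∈ allTuples (suc m) ] 𝟙 (all? (λ i → P? i (a i)))
      ≡⟨ ≡.trans (∑-allTuples-suc _) (∑-cong elems (λ k → ∑-cong (allTuples m) (λ a → 𝟙-all?-suc (λ i → P? i _)))) ⟩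
    ∑[ k ∈ elems ] ∑[ a ∈ allTuples m ] (𝟙 (P? zero k) *ℕ 𝟙 (all? (λ i → P? (suc i) (a i))))
      ≡⟨ ∑-cong elems (λ k → *-distribˡ-∑ (𝟙 (P? zero k)) (allTuples m) _) ⟨
    ∑[ k ∈ elems ] (𝟙 (P? zero k) *ℕ ∑[ a ∈ allTuples m ] 𝟙 (all? (λ i → P? (suc i) (a i))))
      ≡⟨ ∑-cong elems (λ k → ≡.cong (𝟙 (P? zero k) *ℕ_) (∑-allTuples-all? m (P? ∘ suc) (count ∘ suc))) ⟩
    ∑[ k ∈ elems ] (𝟙 (P? zero k) *ℕ c ^ m)
      ≡⟨ *-distribʳ-∑ (c ^ m) elems _ ⟨
    ∑[ k ∈ elems ] 𝟙 (P? zero k) *ℕ c ^ m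
      ≡⟨ ≡.cong (_*ℕ c ^ m) (count zero) ⟩
    c ^ suc m ∎

  ∑-linearForm-unitHead : ∀ m (c : Tuple (suc m)) → IsUnit (c zero) → ∀ t {ψ : Carrier → ℕ} → ψ Preserves _≈_ ⟶ _≡_ →
                          ∑[ a ∈ allTuples (suc m) ] ψ (t + c · a) ≡ ∣K∣ ^ m *ℕ ∑ elems ψ
  ∑-linearForm-unitHead m c unit t {ψ} ψ-resp = begin
    ∑[ a ∈ allTuples (suc m) ] ψ (t + c · a)
      ≡⟨ ≡.trans (∑-allTuples-suc _) (∑-comm elems (allTuples m) _) ⟩
    ∑[ a ∈ allTuples m ] ∑[ k ∈ elems ] ψ (t + (c zero * k + (c ∘ suc) · a))
      ≡⟨ ∑-cong (allTuples m) (λ a → ≡.trans (∑-cong elems (λ k → ψ-resp (regroup a k))) (∑-affine _ unit ψ-resp)) ⟩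
    ∑[ a ∈ allTuples m ] ∑ elems ψ
      ≡⟨ ∑-allTuples-const m _ ⟩
    ∣K∣ ^ m *ℕ ∑ elems ψ ∎
    where
    regroup : ∀ a k → t + (c zero * k + (c ∘ suc) · a) ≈ (t + (c ∘ suc) · a) + c zero * k
    regroup a k = solve 3 (λ t x y → t :+ (x :+ y) := (t :+ y) :+ x) refl t (c zero * k) ((c ∘ suc) · a)

  ∑-linearForm : ∀ m (c : Tuple m) → (∃ λ i → IsUnit (c i)) → ∀ t {ψ : Carrier → ℕ} → ψ Preserves _≈_ ⟶ _≡_ →
                 ∑[ a ∈ allTuples m ] ψ (t + c · a) *ℕ ∣K∣ ≡ ∣K∣ ^ m *ℕ ∑ elems ψ
  ∑-linearForm zero c (() , _) t ψ-resp
  ∑-linearForm (suc m) c unitEntry t {ψ} ψ-resp with ∃-toSum unitEntry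
  ... | inj₁ unit = begin
    ∑[ a ∈ allTuples (suc m) ] ψ (t + c · a) *ℕ ∣K∣  ≡⟨ ≡.cong (_*ℕ ∣K∣) (∑-linearForm-unitHead m c unit t ψ-resp) ⟩
    ∣K∣ ^ m *ℕ ∑ elems ψ *ℕ ∣K∣                      ≡⟨ ℕ.*-comm _ ∣K∣ ⟩
    ∣K∣ *ℕ (∣K∣ ^ m *ℕ ∑ elems ψ)                    ≡⟨ ℕ.*-assoc ∣K∣ _ _ ⟨
    ∣K∣ ^ suc m *ℕ ∑ elems ψ                         ∎
  ... | inj₂ tailUnit = begin
    ∑[ a ∈ allTuples (suc m) ] ψ (t + c · a) *ℕ ∣K∣
      ≡⟨ ≡.trans (≡.cong (_*ℕ ∣K∣) (∑-allTuples-suc _)) (*-distribʳ-∑ ∣K∣ elems _) ⟩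
    ∑[ k ∈ elems ] (∑[ a ∈ allTuples m ] ψ (t + (c zero * k + (c ∘ suc) · a)) *ℕ ∣K∣)
      ≡⟨ ∑-cong elems (λ k → ≡.trans (≡.cong (_*ℕ ∣K∣) (∑-cong (allTuples m) (λ a → ψ-resp (sym (+-assoc t _ _)))))
                                      (∑-linearForm m (c ∘ suc) tailUnit (t + c zero * k) ψ-resp)) ⟩
    ∑[ k ∈ elems ] (∣K∣ ^ m *ℕ ∑ elems ψ)
      ≡⟨ ∑-const elems _ ⟩
    ∣K∣ *ℕ (∣K∣ ^ m *ℕ ∑ elems ψ)
      ≡⟨ ℕ.*-assoc ∣K∣ _ _ ⟨
    ∣K∣ ^ suc m *ℕ ∑ elems ψ ∎

module ThreeIdeals (F : FiniteCommRing) (r : FiniteCommRing.Carrier F) (three : Over.ExactlyThreeIdeals F r) where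
  open FiniteCommRing F hiding (zero)
  open Over F
  open WithJ r
  open Units F
  open DotProduct F
  open ℤ-RingSolver ring using (solve; _:=_; _:+_; _:*_; _:-_; con)
  open import Algebra.Properties.Ring (CommutativeRing.ring ring) using (-1*x≈-x)
  open import Data.Fin using (Fin; zero; suc)
  open import Relation.Binary.Reasoning.Setoid setoid
  open import Data.Product using (_,_; proj₁; proj₂; _×_)
  open import Data.Sum using (_⊎_; inj₁; inj₂)
  open import Data.Empty using (⊥-elim)
  open import Relation.Nullary using (Dec; ¬?)
  open import Function using (_∘_; Equivalence; _⇔_; mk⇔)
  open import Relation.Nullary.Decidable using (_×-dec_)

  principal : ∀ x → IsIdeal ⟨ x ⟩
  principal x = record
    { resp = λ { a≈b (s , a≈sx) → s , trans (sym a≈b) a≈sx }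
    ; has0 = 0# , sym (zeroˡ x)
    ; +-cl = λ { (s , a≈sx) (t , b≈tx) → s + t , trans (+-cong a≈sx b≈tx) (sym (distribʳ x s t)) }
    ; *-cl = λ { c (s , a≈sx) → c * s , trans (*-congˡ a≈sx) (sym (*-assoc c s x)) }
    }

  open IsIdeal (principal r) public using () renaming (resp to J-resp; has0 to J-0; +-cl to J-+; *-cl to J-*ˡ)

  x∈⟨x⟩ : ∀ x → ⟨ x ⟩ x
  x∈⟨x⟩ x = 1# , sym (*-identityˡ x)

  r≉0 : ¬ r ≈ 0#
  r≉0 = proj₁ three

  1∉J : ¬ J 1#
  1∉J = proj₁ (proj₂ three)

  J-*ʳ : ∀ c {a} → J a → J (a * c)
  J-*ʳ c a∈J = J-resp (*-comm c _) (J-*ˡ c a∈J)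

  J-neg : ∀ {a} → J a → J (- a)
  J-neg a∈J = J-resp (-1*x≈-x _) (J-*ˡ (- 1#) a∈J)

  J-sub : ∀ {a b} → J a → J b → J (a - b)
  J-sub a∈J b∈J = J-+ a∈J (J-neg b∈J)

  r∈J : J r
  r∈J = x∈⟨x⟩ r

  unit⇒∉J : ∀ {a} → IsUnit a → ¬ J a
  unit⇒∉J (b , ab≈1) a∈J = 1∉J (J-resp ab≈1 (J-*ʳ b a∈J))

  nonunit⇒∈J : ∀ {a} → ¬ IsUnit a → J a
  nonunit⇒∈J {a} ¬unit with proj₂ (proj₂ three) ⟨ a ⟩ (principal a)
  ... | inj₁ ⟨a⟩≡0 = J-resp (sym (Equivalence.to (⟨a⟩≡0 a) (x∈⟨x⟩ a))) J-0
  ... | inj₂ (inj₁ ⟨a⟩≡J) = Equivalence.to (⟨a⟩≡J a) (x∈⟨x⟩ a)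
  ... | inj₂ (inj₂ ⟨a⟩≡K) with ⟨a⟩≡K 1#
  ... | s , 1≈sa = ⊥-elim (¬unit (s , trans (*-comm a s) (sym 1≈sa)))

  unit⊎∈J : ∀ a → IsUnit a ⊎ J a
  unit⊎∈J a with IsUnit? a
  ... | yes unit = inj₁ unit
  ... | no ¬unit = inj₂ (nonunit⇒∈J ¬unit)

  unit-+J : ∀ {a j} → IsUnit a → J j → IsUnit (a + j)
  unit-+J {a} {j} unit j∈J with unit⊎∈J (a + j)
  ... | inj₁ unit′ = unit′
  ... | inj₂ a+j∈J = ⊥-elim (unit⇒∉J unit (J-resp (solve 2 (λ a j → (a :+ j) :- j := a) refl a j) (J-sub a+j∈J j∈J)))

  unit-*J : ∀ {u a} → IsUnit u → J (u * a) → J a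
  unit-*J {u} {a} (v , uv≈1) ua∈J = J-resp (uv≈1⇒v[ua]≈a uv≈1 a) (J-*ˡ v ua∈J)

  -- ⟨r²⟩ = J would give r = s r², i.e. r (1 - s r) = 0 with 1 - s r a unit.
  r²≈0 : r * r ≈ 0#
  r²≈0 with proj₂ (proj₂ three) ⟨ r * r ⟩ (principal (r * r))
  ... | inj₁ ⟨r²⟩≡0 = Equivalence.to (⟨r²⟩≡0 (r * r)) (x∈⟨x⟩ (r * r))
  ... | inj₂ (inj₂ ⟨r²⟩≡K) = ⊥-elim (1∉J (J-resp (sym 1≈sr²) (J-*ˡ s (J-*ˡ r r∈J))))
    where
    s : Carrier
    s = proj₁ (⟨r²⟩≡K 1#)
    1≈sr² : 1# ≈ s * (r * r)
    1≈sr² = proj₂ (⟨r²⟩≡K 1#)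
  ... | inj₂ (inj₁ ⟨r²⟩≡J) with Equivalence.from (⟨r²⟩≡J r) r∈J
  ... | s , r≈sr² = ⊥-elim (r≉0 (unit-cancelˡ (unit-+J unit-1 (J-neg (J-*ˡ s r∈J))) (begin
      (1# - s * r) * r  ≈⟨ solve 2 (λ r s → (con (ℤ.+ 1) :- s :* r) :* r := r :- s :* (r :* r)) refl r s ⟩
      r - s * (r * r)   ≈⟨ +-congˡ (-‿cong (sym r≈sr²)) ⟩
      r - r             ≈⟨ -‿inverseʳ r ⟩
      0#                ≈⟨ zeroʳ _ ⟨
      (1# - s * r) * 0# ∎)))

  r*J≈0 : ∀ {a} → J a → r * a ≈ 0#
  r*J≈0 {a} (s , a≈sr) = begin
    r * a         ≈⟨ *-congˡ a≈sr ⟩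
    r * (s * r)   ≈⟨ solve 2 (λ r s → r :* (s :* r) := s :* (r :* r)) refl r s ⟩
    s * (r * r)   ≈⟨ *-congˡ r²≈0 ⟩
    s * 0#        ≈⟨ zeroʳ s ⟩
    0#            ∎

  r*a≈0⇒a∈J : ∀ {a} → r * a ≈ 0# → J a
  r*a≈0⇒a∈J {a} ra≈0 with unit⊎∈J a
  ... | inj₂ a∈J = a∈J
  ... | inj₁ unit = ⊥-elim (r≉0 (unit-cancelˡ unit (trans (*-comm a r) (trans ra≈0 (sym (zeroʳ a))))))

  sumF-J : ∀ m (f : Fin m → Carrier) → (∀ i → J (f i)) → J (sumF m f)
  sumF-J zero f f∈J = J-0
  sumF-J (suc m) f f∈J = J-+ (f∈J zero) (sumF-J m (f ∘ suc) (f∈J ∘ suc))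

  J-·ˡ : ∀ {m} {c : Tuple m} → (∀ i → J (c i)) → ∀ a → J (c · a)
  J-·ˡ {m} c∈J a = sumF-J m _ (λ i → J-*ʳ (a i) (c∈J i))

  J-·ʳ : ∀ {m} c {a : Tuple m} → (∀ i → J (a i)) → J (c · a)
  J-·ʳ {m} c a∈J = sumF-J m _ (λ i → J-*ˡ (c i) (a∈J i))

  a-b∈J⇒ra≈rb : ∀ {a b} → J (a - b) → r * a ≈ r * b
  a-b∈J⇒ra≈rb {a} {b} a-b∈J = begin
    r * a                 ≈⟨ solve 3 (λ r a b → r :* a := r :* (a :- b) :+ r :* b) refl r a b ⟩
    r * (a - b) + r * b   ≈⟨ +-congʳ (r*J≈0 a-b∈J) ⟩
    0# + r * b            ≈⟨ +-identityˡ _ ⟩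
    r * b                 ∎

  ra≈rb⇒a-b∈J : ∀ {a b} → r * a ≈ r * b → J (a - b)
  ra≈rb⇒a-b∈J {a} {b} ra≈rb = r*a≈0⇒a∈J (begin
    r * (a - b)           ≈⟨ solve 3 (λ r a b → r :* (a :- b) := r :* a :- r :* b) refl r a b ⟩
    r * a - r * b         ≈⟨ +-congʳ ra≈rb ⟩
    r * b - r * b         ≈⟨ -‿inverseʳ _ ⟩
    0#                    ∎)

  J∖0 : Carrier → Set
  J∖0 a = J a × ¬ a ≈ 0#

  J∖0? : ∀ a → Dec (J∖0 a)
  J∖0? a = J? a ×-dec ¬? (a ≟ 0#)

  J∖0-resp : ∀ {a b} → a ≈ b → J∖0 a → J∖0 b
  J∖0-resp a≈b (a∈J , a≉0) = J-resp a≈b a∈J , λ b≈0 → a≉0 (trans a≈b b≈0)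

  J∖0-unitMultiple : ∀ {u a b} → IsUnit u → a ≈ u * b → J∖0 a ⇔ J∖0 b
  J∖0-unitMultiple {u} {a} {b} unit a≈ub = mk⇔
    (λ (a∈J , a≉0) → unit-*J unit (J-resp a≈ub a∈J) , λ b≈0 → a≉0 (trans a≈ub (trans (*-congˡ b≈0) (zeroʳ u))))
    (λ (b∈J , b≉0) → J-resp (sym a≈ub) (J-*ˡ u b∈J) , λ a≈0 → b≉0 (unit-cancelˡ unit (trans (sym a≈ub) (trans a≈0 (sym (zeroʳ u))))))

module ResidueCounts (F : FiniteCommRing) (r : FiniteCommRing.Carrier F) (three : Over.ExactlyThreeIdeals F r) where
  open FiniteCommRing F hiding (zero)
  open Over F
  open WithJ r
  open Units F
  open ElementSums F
  open TupleSums F using (∣K∣)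
  open ThreeIdeals F r three
  open ListSum
  open ℤ-RingSolver ring using (solve; _:=_; _:+_; _:*_; :-_; _:-_)
  open import Algebra.Properties.Ring (CommutativeRing.ring ring) using (-1*x≈-x)
  open import Data.List using (length)
  import Data.List.Relation.Unary.All as All
  import Data.List.Relation.Unary.Any as Any
  open import Function using (_∘_)
  open import Data.Nat using (≢-nonZero) renaming (_+_ to _+ℕ_; _*_ to _*ℕ_)
  import Data.Nat.Properties as ℕ
  open import Data.Product using (_,_)
  open import Data.Empty using (⊥-elim)
  open import Relation.Nullary using (¬?)
  open import Relation.Binary.PropositionalEquality using (_≢_)
  open import Relation.Binary.Bundles using (DecSetoid)
  open import Relation.Binary.Core using (_Preserves_⟶_)
  open ≡.≡-Reasoning

  q : ℕ
  q = residueSize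

  ∣J∣ : ℕ
  ∣J∣ = ∑[ k ∈ elems ] 𝟙 (J? k)

  𝟙J-resp : (λ k → 𝟙 (J? k)) Preserves _≈_ ⟶ _≡_
  𝟙J-resp {a} {b} a≈b = 𝟙-cong (J? a) (J? b) (J-resp a≈b) (J-resp (sym a≈b))

  𝟙J∖0-resp : (λ k → 𝟙 (J∖0? k)) Preserves _≈_ ⟶ _≡_
  𝟙J∖0-resp {a} {b} a≈b = 𝟙-cong (J∖0? a) (J∖0? b) (J∖0-resp a≈b) (J∖0-resp (sym a≈b))

  congruenceModJ : DecSetoid _ _
  congruenceModJ = record
    { Carrier = Carrier
    ; _≈_ = λ a b → J (a - b)
    ; isDecEquivalence = record
      { isEquivalence = record
        { refl = λ {a} → J-resp (sym (-‿inverseʳ a)) J-0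
        ; sym = λ {a} {b} a-b∈J → J-resp (solve 2 (λ a b → :- (a :- b) := b :- a) refl a b) (J-neg a-b∈J)
        ; trans = λ {a} {b} {c} a-b∈J b-c∈J → J-resp (solve 3 (λ a b c → (a :- b) :+ (b :- c) := a :- c) refl a b c) (J-+ a-b∈J b-c∈J)
        }
      ; _≟_ = λ a b → J? (a - b)
      }
    }

  ∣K∣≡∣J∣*q : ∣K∣ ≡ ∣J∣ *ℕ q
  ∣K∣≡∣J∣*q = Classes.length≡*#classes congruenceModJ elems ∣J∣ (All.tabulate (λ {a} _ → cosetSize a))
    where
    cosetSize : ∀ a → ∑[ k ∈ elems ] 𝟙 (J? (a - k)) ≡ ∣J∣
    cosetSize a = ≡.trans (∑-cong elems (λ k → 𝟙J-resp (+-congˡ (sym (-1*x≈-x k))))) (∑-affine a (unit-neg unit-1) 𝟙J-resp)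

  ∑-translate-J : ∀ s → ∑[ k ∈ elems ] 𝟙 (J? (k - s)) ≡ ∣J∣
  ∑-translate-J s = ≡.trans (∑-cong elems (λ k → 𝟙J-resp (+-comm k (- s)))) (∑-translate (- s) 𝟙J-resp)

  ∑-fibre-r* : ∀ j → ∑[ k ∈ elems ] 𝟙 (j ≟ (r * k)) ≡ 𝟙 (J? j) *ℕ ∣J∣
  ∑-fibre-r* j with J? j
  ... | no j∉J = ∑-𝟙-none (λ k → j ≟ (r * k)) elems (λ k j≈rk → j∉J (J-resp (sym j≈rk) (J-*ʳ k r∈J)))
  ... | yes (s , j≈sr) = begin
    ∑[ k ∈ elems ] 𝟙 (j ≟ (r * k))
      ≡⟨ ∑-cong elems (λ k → 𝟙-cong (j ≟ (r * k)) (J? (k - s)) (ra≈rb⇒a-b∈J ∘ to) (from ∘ a-b∈J⇒ra≈rb)) ⟩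
    ∑[ k ∈ elems ] 𝟙 (J? (k - s))      ≡⟨ ∑-translate-J s ⟩
    ∣J∣                                ≡⟨ ℕ.+-identityʳ ∣J∣ ⟨
    1 *ℕ ∣J∣                           ∎
    where
    j≈rs : j ≈ r * s
    j≈rs = trans j≈sr (*-comm s r)
    to : ∀ {k} → j ≈ r * k → r * k ≈ r * s
    to j≈rk = trans (sym j≈rk) j≈rs
    from : ∀ {k} → r * k ≈ r * s → j ≈ r * k
    from rk≈rs = trans j≈rs (sym rk≈rs)

  ∣K∣≡∣J∣*∣J∣ : ∣K∣ ≡ ∣J∣ *ℕ ∣J∣
  ∣K∣≡∣J∣*∣J∣ = begin
    ∣K∣                                               ≡⟨ ℕ.*-identityʳ ∣K∣ ⟨
    ∣K∣ *ℕ 1                                          ≡⟨ ∑-const elems 1 ⟨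
    ∑[ k ∈ elems ] 1                                  ≡⟨ ∑-cong elems (λ k → ∑-δ (r * k)) ⟨
    ∑[ k ∈ elems ] ∑[ j ∈ elems ] 𝟙 (j ≟ (r * k))       ≡⟨ ∑-comm elems elems _ ⟩
    ∑[ j ∈ elems ] ∑[ k ∈ elems ] 𝟙 (j ≟ (r * k))       ≡⟨ ∑-cong elems ∑-fibre-r* ⟩
    ∑[ j ∈ elems ] (𝟙 (J? j) *ℕ ∣J∣)                  ≡⟨ *-distribʳ-∑ ∣J∣ elems _ ⟨
    ∣J∣ *ℕ ∣J∣                                        ∎

  ∣J∣≡q : ∣J∣ ≡ q
  ∣J∣≡q = ℕ.*-cancelˡ-≡ ∣J∣ q ∣J∣ {{≢-nonZero ∣J∣≢0}} (≡.trans (≡.sym ∣K∣≡∣J∣*∣J∣) ∣K∣≡∣J∣*q)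
    where
    ∣J∣≢0 : ¬ ∣J∣ ≡ 0
    ∣J∣≢0 = ∑-𝟙-≢0 J? (Any.map (λ 0≈k → J-resp 0≈k J-0) (complete 0#))

  ∣K∣≡q*q : ∣K∣ ≡ q *ℕ q
  ∣K∣≡q*q = ≡.trans ∣K∣≡∣J∣*q (≡.cong (_*ℕ q) ∣J∣≡q)

  ∣K×∣+q≡q*q : ∣K×∣ +ℕ q ≡ q *ℕ q
  ∣K×∣+q≡q*q = begin
    ∣K×∣ +ℕ q                                      ≡⟨ ≡.cong (∣K×∣ +ℕ_) ∣J∣≡q ⟨
    ∣K×∣ +ℕ ∣J∣                                    ≡⟨ ∑-distrib-+ elems _ _ ⟨
    ∑[ k ∈ elems ] (𝟙 (IsUnit? k) +ℕ 𝟙 (J? k))     ≡⟨ ∑-cong elems unitOrJ ⟩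
    ∑[ k ∈ elems ] 1                               ≡⟨ ∑-const elems 1 ⟩
    ∣K∣ *ℕ 1                                       ≡⟨ ℕ.*-identityʳ ∣K∣ ⟩
    ∣K∣                                            ≡⟨ ∣K∣≡q*q ⟩
    q *ℕ q                                         ∎
    where
    unitOrJ : ∀ k → 𝟙 (IsUnit? k) +ℕ 𝟙 (J? k) ≡ 1
    unitOrJ k = ≡.trans (≡.cong (𝟙 (IsUnit? k) +ℕ_) (𝟙-cong (J? k) (¬? (IsUnit? k)) (λ k∈J unit → unit⇒∉J unit k∈J) nonunit⇒∈J))
                        (𝟙-¬ (IsUnit? k) (¬? (IsUnit? k)))

  ∣J∖0∣ : ℕ
  ∣J∖0∣ = ∑[ k ∈ elems ] 𝟙 (J∖0? k)

  𝟙J∖0+𝟙≈0≡𝟙J : ∀ k → 𝟙 (J∖0? k) +ℕ 𝟙 (k ≟ 0#) ≡ 𝟙 (J? k)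
  𝟙J∖0+𝟙≈0≡𝟙J k with J? k | k ≟ 0#
  ... | yes _ | yes _ = ≡.refl
  ... | yes _ | no _ = ≡.refl
  ... | no k∉J | yes k≈0 = ⊥-elim (k∉J (J-resp (sym k≈0) J-0))
  ... | no _ | no _ = ≡.refl

  ∣J∖0∣+1≡q : ∣J∖0∣ +ℕ 1 ≡ q
  ∣J∖0∣+1≡q = begin
    ∣J∖0∣ +ℕ 1                                     ≡⟨ ≡.cong (∣J∖0∣ +ℕ_) (∑-δ 0#) ⟨
    ∣J∖0∣ +ℕ ∑[ k ∈ elems ] 𝟙 (k ≟ 0#)             ≡⟨ ∑-distrib-+ elems _ _ ⟨
    ∑[ k ∈ elems ] (𝟙 (J∖0? k) +ℕ 𝟙 (k ≟ 0#))      ≡⟨ ∑-cong elems 𝟙J∖0+𝟙≈0≡𝟙J ⟩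
    ∣J∣                                            ≡⟨ ∣J∣≡q ⟩
    q                                              ∎

  ∣J∖0∣≢0 : ∣J∖0∣ ≢ 0
  ∣J∖0∣≢0 = ∑-𝟙-≢0 J∖0? (Any.map (λ r≈k → J∖0-resp r≈k (r∈J , r≉0)) (complete r))

  ∑-J∖0-shift : ∀ {a} → J a → ∑[ c ∈ elems ] 𝟙 (J∖0? (a + r * c)) +ℕ q ≡ q *ℕ q
  ∑-J∖0-shift {a} (s , a≈sr) = begin
    ∑[ c ∈ elems ] 𝟙 (J∖0? (a + r * c)) +ℕ q
      ≡⟨ ≡.cong (∑[ c ∈ elems ] 𝟙 (J∖0? (a + r * c)) +ℕ_) zeros ⟨
    ∑[ c ∈ elems ] 𝟙 (J∖0? (a + r * c)) +ℕ ∑[ c ∈ elems ] 𝟙 ((a + r * c) ≟ 0#)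
      ≡⟨ ∑-distrib-+ elems _ _ ⟨
    ∑[ c ∈ elems ] (𝟙 (J∖0? (a + r * c)) +ℕ 𝟙 ((a + r * c) ≟ 0#))
      ≡⟨ ∑-cong elems (λ c → ≡.trans (𝟙J∖0+𝟙≈0≡𝟙J (a + r * c)) (𝟙-yes (J? _) (J-resp (sym (a+rc≈r[c--s] c)) (J-*ʳ _ r∈J)))) ⟩
    ∑[ c ∈ elems ] 1
      ≡⟨ ≡.trans (∑-const elems 1) (≡.trans (ℕ.*-identityʳ ∣K∣) ∣K∣≡q*q) ⟩
    q *ℕ q ∎
    where
    a+rc≈r[c--s] : ∀ c → a + r * c ≈ r * (c - - s)
    a+rc≈r[c--s] c = trans (+-congʳ a≈sr) (solve 3 (λ r s c → s :* r :+ r :* c := r :* (c :- (:- s))) refl r s c)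
    to : ∀ {c} → a + r * c ≈ 0# → J (c - - s)
    to {c} a+rc≈0 = r*a≈0⇒a∈J (trans (sym (a+rc≈r[c--s] c)) a+rc≈0)
    from : ∀ {c} → J (c - - s) → a + r * c ≈ 0#
    from {c} c+s∈J = trans (a+rc≈r[c--s] c) (r*J≈0 c+s∈J)
    zeros : ∑[ c ∈ elems ] 𝟙 ((a + r * c) ≟ 0#) ≡ q
    zeros = ≡.trans (∑-cong elems (λ c → 𝟙-cong ((a + r * c) ≟ 0#) (J? (c - - s)) to from))
                    (≡.trans (∑-translate-J (- s)) ∣J∣≡q)

module SumsOverJ (F : FiniteCommRing) (r : FiniteCommRing.Carrier F) (three : Over.ExactlyThreeIdeals F r) where
  open FiniteCommRing F hiding (zero)
  open Over F
  open WithJ r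
  open Units F
  open ElementSums F
  open DotProduct F
  open TupleSums F
  open ThreeIdeals F r three
  open ResidueCounts F r three
  open ListSum
  open ℤ-RingSolver ring using (solve; _:=_; _:+_; _:-_)
  open import Data.Fin using (zero; suc)
  open import Data.Fin.Properties using (all?; any?; ∃-toSum)
  open import Data.Nat using (_^_) renaming (_*_ to _*ℕ_)
  import Data.Nat.Properties as ℕ
  open import Data.Empty using (⊥-elim)
  open import Algebra.Properties.CommutativeSemigroup ℕ.*-commutativeSemigroup using (xy∙z≈y∙xz)
  open import Data.Product using (∃; _,_)
  open import Data.Sum using (inj₁; inj₂)
  open import Function using (_∘_)
  open import Relation.Binary.Core using (_Preserves_⟶_)
  open import Relation.Nullary using (Dec)
  open ≡.≡-Reasoning

  ∑ᴶ : (Carrier → ℕ) → ℕ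
  ∑ᴶ φ = ∑[ j ∈ elems ] (𝟙 (J? j) *ℕ φ j)

  ∑ᴶ-affine : ∀ {s u} → J s → IsUnit u → ∀ {φ : Carrier → ℕ} → φ Preserves _≈_ ⟶ _≡_ →
              ∑ᴶ (λ j → φ (s + u * j)) ≡ ∑ᴶ φ
  ∑ᴶ-affine {s} {u} s∈J unit {φ} φ-resp = begin
    ∑[ j ∈ elems ] (𝟙 (J? j) *ℕ φ (s + u * j))
      ≡⟨ ∑-cong elems (λ j → ≡.cong (_*ℕ φ (s + u * j)) (𝟙-cong (J? j) (J? (s + u * j)) to from)) ⟩
    ∑[ j ∈ elems ] (𝟙 (J? (s + u * j)) *ℕ φ (s + u * j))
      ≡⟨ ∑-affine s unit (λ k≈l → ≡.cong₂ _*ℕ_ (𝟙J-resp k≈l) (φ-resp k≈l)) ⟩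
    ∑ᴶ φ ∎
    where
    to : ∀ {j} → J j → J (s + u * j)
    to j∈J = J-+ s∈J (J-*ˡ u j∈J)
    from : ∀ {j} → J (s + u * j) → J j
    from {j} s+uj∈J = unit-*J unit (J-resp (solve 2 (λ s x → (s :+ x) :- s := x) refl s (u * j)) (J-sub s+uj∈J s∈J))

  ∑ᴶ-translate : ∀ {s} → J s → ∀ t {φ : Carrier → ℕ} → φ Preserves _≈_ ⟶ _≡_ →
                 ∑ᴶ (λ j → φ ((t + s) + j)) ≡ ∑ᴶ (λ j → φ (t + j))
  ∑ᴶ-translate {s} s∈J t {φ} φ-resp = ≡.trans
    (∑-cong elems (λ j → ≡.cong (𝟙 (J? j) *ℕ_) (φ-resp (trans (+-assoc t s j) (+-congˡ (+-congˡ (sym (*-identityˡ j))))))))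
    (∑ᴶ-affine s∈J unit-1 (φ-resp ∘ +-congˡ))

  _∈Jᵐ : ∀ {m} → Tuple m → Set
  a ∈Jᵐ = ∀ i → J (a i)

  _∈Jᵐ? : ∀ {m} (a : Tuple m) → Dec (a ∈Jᵐ)
  a ∈Jᵐ? = all? (J? ∘ a)

  𝟙-∈Jᵐ?-suc : ∀ {m} (a : Tuple (suc m)) → 𝟙 (a ∈Jᵐ?) ≡ 𝟙 (J? (a zero)) *ℕ 𝟙 ((a ∘ suc) ∈Jᵐ?)
  𝟙-∈Jᵐ?-suc a = 𝟙-all?-suc (J? ∘ a)

  ∉Jᵐ⇒unitEntry : ∀ {m} (a : Tuple m) → ¬ a ∈Jᵐ → ∃ λ i → IsUnit (a i)
  ∉Jᵐ⇒unitEntry a a∉Jᵐ with any? (IsUnit? ∘ a)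
  ... | yes unitEntry = unitEntry
  ... | no ¬unitEntry = ⊥-elim (a∉Jᵐ (λ i → nonunit⇒∈J (λ unit → ¬unitEntry (i , unit))))

  count-Jᵐ : ∀ m → ∑[ a ∈ allTuples m ] 𝟙 (a ∈Jᵐ?) ≡ q ^ m
  count-Jᵐ m = ∑-allTuples-all? m (λ _ → J?) (λ _ → ∣J∣≡q)

  ∑-linearFormᴶ-unitHead : ∀ m (c : Tuple (suc m)) → IsUnit (c zero) → ∀ t {ψ : Carrier → ℕ} → ψ Preserves _≈_ ⟶ _≡_ →
                           ∑[ a ∈ allTuples (suc m) ] (𝟙 (a ∈Jᵐ?) *ℕ ψ (t + c · a)) ≡ q ^ m *ℕ ∑ᴶ (λ j → ψ (t + j))
  ∑-linearFormᴶ-unitHead m c unit t {ψ} ψ-resp = begin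
    ∑[ a ∈ allTuples (suc m) ] (𝟙 (a ∈Jᵐ?) *ℕ ψ (t + c · a))
      ≡⟨ ≡.trans (∑-allTuples-suc (λ a → 𝟙 (a ∈Jᵐ?) *ℕ ψ (t + c · a)))
                 (∑-cong elems (λ k → ∑-cong (allTuples m) (λ a → ≡.cong (_*ℕ f k a) (𝟙-∈Jᵐ?-suc _)))) ⟩
    ∑[ k ∈ elems ] ∑[ a ∈ allTuples m ] (𝟙 (J? k) *ℕ 𝟙 (a ∈Jᵐ?) *ℕ f k a)
      ≡⟨ ∑-comm elems (allTuples m) _ ⟩
    ∑[ a ∈ allTuples m ] ∑[ k ∈ elems ] (𝟙 (J? k) *ℕ 𝟙 (a ∈Jᵐ?) *ℕ f k a)
      ≡⟨ ∑-cong (allTuples m) (λ a → ≡.trans (∑-cong elems (λ k → xy∙z≈y∙xz (𝟙 (J? k)) (𝟙 (a ∈Jᵐ?)) (f k a)))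
                                              (≡.sym (*-distribˡ-∑ (𝟙 (a ∈Jᵐ?)) elems (λ k → 𝟙 (J? k) *ℕ f k a)))) ⟩
    ∑[ a ∈ allTuples m ] (𝟙 (a ∈Jᵐ?) *ℕ ∑ᴶ (λ k → f k a))
      ≡⟨ ∑-cong (allTuples m) (λ a → 𝟙*-cong (a ∈Jᵐ?) (shift a)) ⟩
    ∑[ a ∈ allTuples m ] (𝟙 (a ∈Jᵐ?) *ℕ S)
      ≡⟨ ≡.trans (≡.sym (*-distribʳ-∑ S (allTuples m) _)) (≡.cong (_*ℕ S) (count-Jᵐ m)) ⟩
    q ^ m *ℕ S ∎
    where
    f : Carrier → Tuple m → ℕ
    f k a = ψ (t + (c zero * k + (c ∘ suc) · a))
    S : ℕ
    S = ∑ᴶ (λ j → ψ (t + j))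
    shift : ∀ a → (∀ i → J (a i)) → ∑ᴶ (λ k → f k a) ≡ S
    shift a a∈Jᵐ = ≡.trans (∑-cong elems (λ k → ≡.cong (𝟙 (J? k) *ℕ_) (ψ-resp (+-congˡ (+-comm _ _)))))
                           (∑ᴶ-affine (J-·ʳ (c ∘ suc) a∈Jᵐ) unit (ψ-resp ∘ +-congˡ))

  ∑-linearFormᴶ : ∀ m (c : Tuple m) → (∃ λ i → IsUnit (c i)) → ∀ t {ψ : Carrier → ℕ} → ψ Preserves _≈_ ⟶ _≡_ →
                  ∑[ a ∈ allTuples m ] (𝟙 (a ∈Jᵐ?) *ℕ ψ (t + c · a)) *ℕ q ≡ q ^ m *ℕ ∑ᴶ (λ j → ψ (t + j))
  ∑-linearFormᴶ zero c (() , _) t ψ-resp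
  ∑-linearFormᴶ (suc m) c unitEntry t {ψ} ψ-resp with ∃-toSum unitEntry
  ... | inj₁ unit = begin
    ∑[ a ∈ allTuples (suc m) ] (𝟙 (a ∈Jᵐ?) *ℕ ψ (t + c · a)) *ℕ q
      ≡⟨ ≡.cong (_*ℕ q) (∑-linearFormᴶ-unitHead m c unit t ψ-resp) ⟩
    q ^ m *ℕ S *ℕ q                                ≡⟨ ℕ.*-comm _ q ⟩
    q *ℕ (q ^ m *ℕ S)                              ≡⟨ ℕ.*-assoc q _ _ ⟨
    q ^ suc m *ℕ S                                 ∎
    where
    S : ℕ
    S = ∑ᴶ (λ j → ψ (t + j))
  ... | inj₂ tailUnit = begin
    ∑[ a ∈ allTuples (suc m) ] (𝟙 (a ∈Jᵐ?) *ℕ ψ (t + c · a)) *ℕ q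
      ≡⟨ ≡.cong (_*ℕ q) (≡.trans (∑-allTuples-suc (λ a → 𝟙 (a ∈Jᵐ?) *ℕ ψ (t + c · a))) (∑-cong elems (λ k →
           ≡.trans (∑-cong (allTuples m) (λ a → ≡.trans (≡.cong₂ _*ℕ_ (𝟙-∈Jᵐ?-suc _) (ψ-resp (sym (+-assoc t _ _))))
                                                        (ℕ.*-assoc (𝟙 (J? k)) (𝟙 (a ∈Jᵐ?)) (f k a))))
                   (≡.sym (*-distribˡ-∑ (𝟙 (J? k)) (allTuples m) (λ a → 𝟙 (a ∈Jᵐ?) *ℕ f k a)))))) ⟩
    ∑[ k ∈ elems ] (𝟙 (J? k) *ℕ g k) *ℕ q
      ≡⟨ *-distribʳ-∑ q elems _ ⟩
    ∑[ k ∈ elems ] (𝟙 (J? k) *ℕ g k *ℕ q)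
      ≡⟨ ∑-cong elems (λ k → ≡.trans (ℕ.*-assoc (𝟙 (J? k)) (g k) q) (𝟙*-cong (J? k) (tail k))) ⟩
    ∑[ k ∈ elems ] (𝟙 (J? k) *ℕ (q ^ m *ℕ S))
      ≡⟨ ≡.trans (≡.sym (*-distribʳ-∑ _ elems _)) (≡.cong (_*ℕ (q ^ m *ℕ S)) ∣J∣≡q) ⟩
    q *ℕ (q ^ m *ℕ S)                              ≡⟨ ℕ.*-assoc q _ _ ⟨
    q ^ suc m *ℕ S                                 ∎
    where
    S : ℕ
    S = ∑ᴶ (λ j → ψ (t + j))
    f : Carrier → Tuple m → ℕ
    f k a = ψ ((t + c zero * k) + (c ∘ suc) · a)
    g : Carrier → ℕ
    g k = ∑[ a ∈ allTuples m ] (𝟙 (a ∈Jᵐ?) *ℕ f k a)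
    tail : ∀ k → J k → g k *ℕ q ≡ q ^ m *ℕ S
    tail k k∈J = ≡.trans (∑-linearFormᴶ m (c ∘ suc) tailUnit (t + c zero * k) ψ-resp)
                         (≡.cong (q ^ m *ℕ_) (∑ᴶ-translate (J-*ˡ (c zero) k∈J) t ψ-resp))

module TwoLinearForms (F : FiniteCommRing) (r : FiniteCommRing.Carrier F) (three : Over.ExactlyThreeIdeals F r)
  {Φ : FiniteCommRing.Carrier F → FiniteCommRing.Carrier F → ℕ}
  (Φ-respˡ : ∀ {α α′} γ → FiniteCommRing._≈_ F α α′ → Φ α γ ≡ Φ α′ γ)
  (Φ-respʳ : ∀ α {γ γ′} → Over.WithJ.J F r (FiniteCommRing._-_ F γ γ′) → Φ α γ ≡ Φ α γ′) where
  open FiniteCommRing F hiding (zero)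
  open Over F
  open WithJ r
  open ElementSums F
  open DotProduct F
  open TupleSums F
  open ThreeIdeals F r three
  open SumsOverJ F r three
  open ListSum
  open ℤ-RingSolver ring using (solve; _:=_; _:+_; _:*_; :-_; _:-_)
  open import Data.Fin using (zero; suc)
  open import Data.Fin.Properties using (∃-toSum)
  open import Data.Nat using (_^_) renaming (_*_ to _*ℕ_)
  import Data.Nat.Properties as ℕ
  open import Data.Empty using (⊥-elim)
  open import Data.Product using (∃; _,_)
  open import Data.Sum using (inj₁; inj₂)
  open import Function using (_∘_)
  open ≡.≡-Reasoning
  open import Relation.Binary.Reasoning.Setoid setoid using () renaming (begin_ to begin≈_; step-≈-⟩ to step-≈-⟩; _∎ to _∎≈)
  open import Relation.Binary.Core using (_Preserves_⟶_)

  Φ-resp : ∀ {α α′ γ γ′} → α ≈ α′ → γ ≈ γ′ → Φ α γ ≡ Φ α′ γ′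
  Φ-resp {α′ = α′} {γ} {γ′} α≈α′ γ≈γ′ =
    ≡.trans (Φ-respˡ γ α≈α′) (Φ-respʳ α′ (J-resp (sym (trans (+-congʳ γ≈γ′) (-‿inverseʳ γ′))) J-0))

  ∑Φ : ℕ
  ∑Φ = ∑[ α ∈ elems ] ∑[ γ ∈ elems ] Φ α γ

  ∑-twoLinearForms-unitHead : ∀ m (X E : Tuple (suc m)) → IsUnit (X zero) → (∀ s → ∃ λ i → IsUnit (E i + s * X i)) →
                              ∀ t t′ → ∑[ a ∈ allTuples (suc m) ] Φ (t + X · a) (t′ + E · a) *ℕ ∣K∣ ≡ ∣K∣ ^ m *ℕ ∑Φ
  ∑-twoLinearForms-unitHead m X E (w , X₀w≈1) independent t t′ = begin
    ∑[ a ∈ allTuples (suc m) ] Φ (t + X · a) (t′ + E · a) *ℕ ∣K∣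
      ≡⟨ ≡.cong (_*ℕ ∣K∣) (≡.trans (∑-allTuples-suc (λ a → Φ (t + X · a) (t′ + E · a))) (∑-comm elems (allTuples m) _)) ⟩
    ∑[ a ∈ allTuples m ] ∑[ a₀ ∈ elems ] Φ (t + (X₀ * a₀ + X′ · a)) (t′ + (E₀ * a₀ + E′ · a)) *ℕ ∣K∣
      ≡⟨ ≡.cong (_*ℕ ∣K∣) (∑-cong (allTuples m) (λ a → ≡.trans (∑-cong elems (λ a₀ → Φ-resp (regroupˡ a a₀) (regroupʳ a a₀)))
                                                                (∑-affine (t + X′ · a) (w , X₀w≈1) (ψ-resp a)))) ⟩
    ∑[ a ∈ allTuples m ] ∑[ α ∈ elems ] Φ α (T α + E″ · a) *ℕ ∣K∣
      ≡⟨ ≡.trans (≡.cong (_*ℕ ∣K∣) (∑-comm (allTuples m) elems _)) (*-distribʳ-∑ ∣K∣ elems _) ⟩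
    ∑[ α ∈ elems ] (∑[ a ∈ allTuples m ] Φ α (T α + E″ · a) *ℕ ∣K∣)
      ≡⟨ ∑-cong elems (λ α → ∑-linearForm m E″ E″-unitEntry (T α) (Φ-resp refl)) ⟩
    ∑[ α ∈ elems ] (∣K∣ ^ m *ℕ ∑[ γ ∈ elems ] Φ α γ)
      ≡⟨ *-distribˡ-∑ (∣K∣ ^ m) elems _ ⟨
    ∣K∣ ^ m *ℕ ∑Φ ∎
    where
    X₀ E₀ k : Carrier
    X₀ = X zero
    E₀ = E zero
    k = - (E₀ * w)
    X′ E′ : Tuple m
    X′ = X ∘ suc
    E′ = E ∘ suc
    E″ : Tuple m
    E″ i = E′ i + k * X′ i
    T : Carrier → Carrier
    T α = t′ + E₀ * w * (α - t)
    ψ-resp : ∀ a → (λ α → Φ α (T α + E″ · a)) Preserves _≈_ ⟶ _≡_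
    ψ-resp a α≈β = Φ-resp α≈β (+-congʳ (+-congˡ (*-congˡ (+-congʳ α≈β))))
    regroupˡ : ∀ a a₀ → t + (X₀ * a₀ + X′ · a) ≈ (t + X′ · a) + X₀ * a₀
    regroupˡ a a₀ = solve 3 (λ t x l → t :+ (x :+ l) := (t :+ l) :+ x) refl t (X₀ * a₀) (X′ · a)
    regroupʳ : ∀ a a₀ → t′ + (E₀ * a₀ + E′ · a) ≈ T ((t + X′ · a) + X₀ * a₀) + E″ · a
    regroupʳ a a₀ = sym (begin≈
      T ((t + X′ · a) + X₀ * a₀) + E″ · a               ≈⟨ +-congˡ (·-linearˡ E′ X′ k a) ⟩
      T ((t + X′ · a) + X₀ * a₀) + (E′ · a + k * X′ · a) ≈⟨ solve 8 (λ t′ e w t l x a₀ le →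
                                                             (t′ :+ e :* w :* (((t :+ l) :+ x :* a₀) :- t)) :+ (le :+ (:- (e :* w)) :* l)
                                                             := t′ :+ (e :* a₀ :* (x :* w) :+ le)) refl t′ E₀ w t (X′ · a) X₀ a₀ (E′ · a) ⟩
      t′ + (E₀ * a₀ * (X₀ * w) + E′ · a)                 ≈⟨ +-congˡ (+-congʳ (trans (*-congˡ X₀w≈1) (*-identityʳ _))) ⟩
      t′ + (E₀ * a₀ + E′ · a)                            ∎≈)
    E″-unitEntry : ∃ λ i → IsUnit (E″ i)
    E″-unitEntry with ∃-toSum (independent k)
    ... | inj₂ tailUnit = tailUnit
    ... | inj₁ headUnit = ⊥-elim (unit⇒∉J headUnit (J-resp (sym E₀+kX₀≈0) J-0))
      where
      E₀+kX₀≈0 : E₀ + k * X₀ ≈ 0#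
      E₀+kX₀≈0 = trans (solve 3 (λ e w x → e :+ (:- (e :* w)) :* x := e :- e :* (x :* w)) refl E₀ w X₀)
                       (trans (+-congˡ (-‿cong (trans (*-congˡ X₀w≈1) (*-identityʳ E₀)))) (-‿inverseʳ E₀))

  ∑-twoLinearForms-dependentTail : ∀ m (X E : Tuple (suc m)) → (∃ λ i → IsUnit (X (suc i))) →
                                   ∀ s → (∀ i → J (E (suc i) + s * X (suc i))) → IsUnit (E zero + s * X zero) →
                                   ∀ t t′ → ∑[ a ∈ allTuples (suc m) ] Φ (t + X · a) (t′ + E · a) *ℕ ∣K∣ ≡ ∣K∣ ^ m *ℕ ∑Φ
  ∑-twoLinearForms-dependentTail m X E tailUnit s dependent headUnit t t′ = begin
    ∑[ a ∈ allTuples (suc m) ] Φ (t + X · a) (t′ + E · a) *ℕ ∣K∣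
      ≡⟨ ≡.cong (_*ℕ ∣K∣) (≡.trans (∑-allTuples-suc (λ a → Φ (t + X · a) (t′ + E · a)))
                                   (∑-cong elems (λ a₀ → ∑-cong (allTuples m) (λ a → reduce a₀ a)))) ⟩
    ∑[ a₀ ∈ elems ] ∑[ a ∈ allTuples m ] ψ a₀ ((t + X₀ * a₀) + X′ · a) *ℕ ∣K∣
      ≡⟨ *-distribʳ-∑ ∣K∣ elems _ ⟩
    ∑[ a₀ ∈ elems ] (∑[ a ∈ allTuples m ] ψ a₀ ((t + X₀ * a₀) + X′ · a) *ℕ ∣K∣)
      ≡⟨ ∑-cong elems (λ a₀ → ∑-linearForm m X′ tailUnit (t + X₀ * a₀) (ψ-resp a₀)) ⟩
    ∑[ a₀ ∈ elems ] (∣K∣ ^ m *ℕ ∑ elems (ψ a₀))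
      ≡⟨ *-distribˡ-∑ (∣K∣ ^ m) elems _ ⟨
    ∣K∣ ^ m *ℕ ∑[ a₀ ∈ elems ] ∑[ α ∈ elems ] ψ a₀ α
      ≡⟨ ≡.cong (∣K∣ ^ m *ℕ_) (≡.trans (∑-comm elems elems _) (∑-cong elems (λ α → ∑-affine _ headUnit (Φ-resp refl)))) ⟩
    ∣K∣ ^ m *ℕ ∑Φ ∎
    where
    X₀ E₀ : Carrier
    X₀ = X zero
    E₀ = E zero
    X′ E′ : Tuple m
    X′ = X ∘ suc
    E′ = E ∘ suc
    ψ : Carrier → Carrier → ℕ
    ψ a₀ α = Φ α ((t′ + s * t - s * α) + (E₀ + s * X₀) * a₀)
    ψ-resp : ∀ a₀ → ψ a₀ Preserves _≈_ ⟶ _≡_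
    ψ-resp a₀ α≈β = Φ-resp α≈β (+-congʳ (+-congˡ (-‿cong (*-congˡ α≈β))))
    reduce : ∀ a₀ a → Φ (t + (X₀ * a₀ + X′ · a)) (t′ + (E₀ * a₀ + E′ · a)) ≡ ψ a₀ ((t + X₀ * a₀) + X′ · a)
    reduce a₀ a = ≡.trans (Φ-respˡ _ (sym (+-assoc t _ _))) (Φ-respʳ _ (J-resp (sym difference) (J-·ˡ dependent a)))
      where
      difference : (t′ + (E₀ * a₀ + E′ · a)) - ((t′ + s * t - s * ((t + X₀ * a₀) + X′ · a)) + (E₀ + s * X₀) * a₀)
                   ≈ (λ i → E′ i + s * X′ i) · a
      difference = trans (solve 8 (λ t′ e a₀ le s t x lx →
                                     (t′ :+ (e :* a₀ :+ le)) :- ((t′ :+ s :* t :- s :* ((t :+ x :* a₀) :+ lx)) :+ (e :+ s :* x) :* a₀)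
                                     := le :+ s :* lx) refl t′ E₀ a₀ (E′ · a) s t X₀ (X′ · a))
                         (sym (·-linearˡ E′ X′ s a))

  ∑*∣K∣²-suc : ∀ {m S} (f : Tuple (suc m) → ℕ) → ∑ (allTuples (suc m)) f *ℕ ∣K∣ ≡ ∣K∣ ^ m *ℕ S →
               ∑ (allTuples (suc m)) f *ℕ (∣K∣ *ℕ ∣K∣) ≡ ∣K∣ ^ suc m *ℕ S
  ∑*∣K∣²-suc {m} {S} f ∑f*∣K∣≡ = begin
    ∑ (allTuples (suc m)) f *ℕ (∣K∣ *ℕ ∣K∣)  ≡⟨ ℕ.*-assoc (∑ (allTuples (suc m)) f) ∣K∣ ∣K∣ ⟨
    ∑ (allTuples (suc m)) f *ℕ ∣K∣ *ℕ ∣K∣    ≡⟨ ≡.cong (_*ℕ ∣K∣) ∑f*∣K∣≡ ⟩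
    ∣K∣ ^ m *ℕ S *ℕ ∣K∣                      ≡⟨ ℕ.*-comm _ ∣K∣ ⟩
    ∣K∣ *ℕ (∣K∣ ^ m *ℕ S)                    ≡⟨ ℕ.*-assoc ∣K∣ _ S ⟨
    ∣K∣ ^ suc m *ℕ S                         ∎

  -- Φ only sees its second argument modulo J, and the hypotheses on X and E say that their
  -- reductions modulo J are linearly independent.
  ∑-twoLinearForms : ∀ m (X E : Tuple m) → (∃ λ i → IsUnit (X i)) → (∀ s → ∃ λ i → IsUnit (E i + s * X i)) →
                     ∀ t t′ → ∑[ a ∈ allTuples m ] Φ (t + X · a) (t′ + E · a) *ℕ (∣K∣ *ℕ ∣K∣) ≡ ∣K∣ ^ m *ℕ ∑Φ
  ∑-twoLinearForms zero X E (() , _) independent t t′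
  ∑-twoLinearForms (suc m) X E unitEntry independent t t′ with ∃-toSum unitEntry
  ... | inj₁ headUnit = ∑*∣K∣²-suc (λ a → Φ (t + X · a) (t′ + E · a))
      (∑-twoLinearForms-unitHead m X E headUnit independent t t′)
  ... | inj₂ tailUnit with find? (λ s → (λ i → E (suc i) + s * X (suc i)) ∈Jᵐ)
                                 (λ a≈b dependent i → J-resp (+-congˡ (*-congʳ a≈b)) (dependent i))
                                 (λ s → (λ i → E (suc i) + s * X (suc i)) ∈Jᵐ?)
  ...   | yes (s , dependent) = ∑*∣K∣²-suc (λ a → Φ (t + X · a) (t′ + E · a))
      (∑-twoLinearForms-dependentTail m X E tailUnit s dependent headUnit t t′)
    where
    headUnit : IsUnit (E zero + s * X zero)
    headUnit with ∃-toSum (independent s)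
    ... | inj₁ unit = unit
    ... | inj₂ (i , unit) = ⊥-elim (unit⇒∉J unit (dependent i))
  ...   | no independentTail = begin
    ∑[ a ∈ allTuples (suc m) ] Φ (t + X · a) (t′ + E · a) *ℕ (∣K∣ *ℕ ∣K∣)
      ≡⟨ ≡.trans (≡.cong (_*ℕ (∣K∣ *ℕ ∣K∣)) (∑-allTuples-suc (λ a → Φ (t + X · a) (t′ + E · a)))) (*-distribʳ-∑ _ elems _) ⟩
    ∑[ a₀ ∈ elems ] (∑[ a ∈ allTuples m ] Φ (t + (X₀ * a₀ + X′ · a)) (t′ + (E₀ * a₀ + E′ · a)) *ℕ (∣K∣ *ℕ ∣K∣))
      ≡⟨ ∑-cong elems (λ a₀ → ≡.trans (≡.cong (_*ℕ (∣K∣ *ℕ ∣K∣))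
                                        (∑-cong (allTuples m) (λ a → Φ-resp (sym (+-assoc t _ _)) (sym (+-assoc t′ _ _)))))
                                      (∑-twoLinearForms m X′ E′ tailUnit independent′ (t + X₀ * a₀) (t′ + E₀ * a₀))) ⟩
    ∑[ a₀ ∈ elems ] (∣K∣ ^ m *ℕ ∑Φ)
      ≡⟨ ∑-const elems _ ⟩
    ∣K∣ *ℕ (∣K∣ ^ m *ℕ ∑Φ)
      ≡⟨ ℕ.*-assoc ∣K∣ _ _ ⟨
    ∣K∣ ^ suc m *ℕ ∑Φ ∎
    where
    X₀ E₀ : Carrier
    X₀ = X zero
    E₀ = E zero
    X′ E′ : Tuple m
    X′ = X ∘ suc
    E′ = E ∘ suc
    independent′ : ∀ s → ∃ λ i → IsUnit (E′ i + s * X′ i)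
    independent′ s = ∉Jᵐ⇒unitEntry _ (λ dependent → independentTail (s , dependent))

module Symplectic (F : FiniteCommRing) (r : FiniteCommRing.Carrier F) (e : ℕ) where
  open FiniteCommRing F hiding (zero)
  open Over F
  open WithJ r
  open Dim e
  open Units F
  open DotProduct F
  open ℤ-RingSolver ring using (solve; _:=_; _:+_; _:*_; :-_; _:-_)
  open import Data.Fin using (_↑ˡ_; _↑ʳ_; splitAt)
  open import Data.Fin.Properties using (splitAt-↑ˡ; splitAt-↑ʳ; splitAt⁻¹-↑ˡ; splitAt⁻¹-↑ʳ)
  open import Data.Product using (∃; _,_)
  open import Data.Sum using (inj₁; inj₂; [_,_]′)
  open import Function using (_∘_)
  open import Relation.Binary.Reasoning.Setoid setoid

  Ω : Vec → Vec
  Ω b j = [ (λ i → b (e ↑ʳ i)) , (λ i → - b (i ↑ˡ e)) ]′ (splitAt e j)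

  Ω-↑ˡ : ∀ b i → Ω b (i ↑ˡ e) ≡ b (e ↑ʳ i)
  Ω-↑ˡ b i = ≡.cong [ _ , _ ]′ (splitAt-↑ˡ e i e)

  Ω-↑ʳ : ∀ b i → Ω b (e ↑ʳ i) ≡ - b (i ↑ˡ e)
  Ω-↑ʳ b i = ≡.cong [ _ , _ ]′ (splitAt-↑ʳ e e i)

  form≈Ω· : ∀ a b → form a b ≈ Ω b · a
  form≈Ω· a b = begin
    form a b
      ≈⟨ sumF-cong e (λ i → solve 4 (λ al br ar bl → al :* br :- ar :* bl := br :* al :+ (:- bl) :* ar) refl
                                  (a (i ↑ˡ e)) (b (e ↑ʳ i)) (a (e ↑ʳ i)) (b (i ↑ˡ e))) ⟩
    sumF e (λ i → b (e ↑ʳ i) * a (i ↑ˡ e) + - b (i ↑ˡ e) * a (e ↑ʳ i))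
      ≈⟨ sumF-+ e _ _ ⟩
    sumF e (λ i → b (e ↑ʳ i) * a (i ↑ˡ e)) + sumF e (λ i → - b (i ↑ˡ e) * a (e ↑ʳ i))
      ≈⟨ +-cong (sumF-cong e (λ i → *-congʳ (reflexive (≡.sym (Ω-↑ˡ b i))))) (sumF-cong e (λ i → *-congʳ (reflexive (≡.sym (Ω-↑ʳ b i))))) ⟩
    sumF e (λ i → Ω b (i ↑ˡ e) * a (i ↑ˡ e)) + sumF e (λ i → Ω b (e ↑ʳ i) * a (e ↑ʳ i))
      ≈⟨ sumF-split e e _ ⟨
    Ω b · a ∎

  Ω-cong : ∀ {b c} → (∀ i → b i ≈ c i) → ∀ j → Ω b j ≈ Ω c j
  Ω-cong b≈c j with splitAt e j
  ... | inj₁ i = b≈c (e ↑ʳ i)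
  ... | inj₂ i = -‿cong (b≈c (i ↑ˡ e))

  Ω-linear : ∀ b k c j → Ω (λ i → b i + k * c i) j ≈ Ω b j + k * Ω c j
  Ω-linear b k c j with splitAt e j
  ... | inj₁ i = refl
  ... | inj₂ i = solve 3 (λ x k y → :- (x :+ k :* y) := :- x :+ k :* (:- y)) refl (b (i ↑ˡ e)) k (c (i ↑ˡ e))

  Ω-scale : ∀ k b j → Ω (λ i → k * b i) j ≈ k * Ω b j
  Ω-scale k b j with splitAt e j
  ... | inj₁ i = refl
  ... | inj₂ i = solve 2 (λ k y → :- (k :* y) := k :* (:- y)) refl k (b (i ↑ˡ e))

  Ω-unitEntry : ∀ {b} → (∃ λ j → IsUnit (b j)) → ∃ λ j → IsUnit (Ω b j)
  Ω-unitEntry {b} (j , unit) with splitAt e j in eq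
  ... | inj₁ i = e ↑ʳ i , ≡.subst IsUnit (≡.sym (Ω-↑ʳ b i)) (unit-neg (≡.subst (IsUnit ∘ b) (≡.sym (splitAt⁻¹-↑ˡ eq)) unit))
  ... | inj₂ i = i ↑ˡ e , ≡.subst IsUnit (≡.sym (Ω-↑ˡ b i)) (≡.subst (IsUnit ∘ b) (≡.sym (splitAt⁻¹-↑ʳ eq)) unit)

  form-scaleˡ : ∀ {a a′} l b → (∀ i → a′ i ≈ l * a i) → form a′ b ≈ l * form a b
  form-scaleˡ {a} {a′} l b a′≈la = begin
    form a′ b                   ≈⟨ form≈Ω· a′ b ⟩
    Ω b · a′                    ≈⟨ ·-cong (λ _ → refl) a′≈la ⟩
    Ω b · (λ i → l * a i)       ≈⟨ ·-scaleʳ l (Ω b) a ⟩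
    l * (Ω b · a)               ≈⟨ *-congˡ (form≈Ω· a b) ⟨
    l * form a b                ∎

  form-scaleʳ : ∀ a {b b′} l → (∀ i → b′ i ≈ l * b i) → form a b′ ≈ l * form a b
  form-scaleʳ a {b} {b′} l b′≈lb = begin
    form a b′                   ≈⟨ form≈Ω· a b′ ⟩
    Ω b′ · a                    ≈⟨ ·-cong (λ j → trans (Ω-cong b′≈lb j) (Ω-scale l b j)) (λ _ → refl) ⟩
    (λ j → l * Ω b j) · a       ≈⟨ ·-scaleˡ l (Ω b) a ⟩
    l * (Ω b · a)               ≈⟨ *-congˡ (form≈Ω· a b) ⟨
    l * form a b                ∎

module ProjectiveClasses (F : FiniteCommRing) (r : FiniteCommRing.Carrier F) (e : ℕ) where
  open FiniteCommRing F hiding (zero)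
  open Over F
  open WithJ r
  open Dim e
  open Units F
  open ElementSums F
  open TupleSums F
  open ListSum
  open import Data.Fin.Properties using (all?)
  open import Data.Nat using (_^_) renaming (_*_ to _*ℕ_)
  import Data.Nat.Properties as ℕ
  open import Data.Product using (_×_; _,_)
  open import Relation.Binary.Bundles using (DecSetoid)
  open import Relation.Nullary using (Dec)
  open import Relation.Nullary.Decidable using (_×-dec_)
  open import Data.List using (filter; length)
  import Data.List.Relation.Unary.All as All
  import Data.List.Relation.Unary.All.Properties as All
  open ≡.≡-Reasoning

  ∼-refl : ∀ a → a ∼ a
  ∼-refl a = 1# , unit-1 , λ i → sym (*-identityˡ (a i))

  ∼-sym : ∀ {a b} → a ∼ b → b ∼ a
  ∼-sym {a} {b} (l , (l⁻¹ , ll⁻¹≈1) , b≈la) = l⁻¹ , unit-inverse (l⁻¹ , ll⁻¹≈1) ,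
    λ i → sym (trans (*-congˡ (b≈la i)) (uv≈1⇒v[ua]≈a ll⁻¹≈1 (a i)))

  ∼-trans : ∀ {a b c} → a ∼ b → b ∼ c → a ∼ c
  ∼-trans {a} (l , l-unit , b≈la) (m , m-unit , c≈mb) =
    m * l , unit-* m-unit l-unit , λ i → trans (c≈mb i) (trans (*-congˡ (b≈la i)) (sym (*-assoc m l (a i))))

  projectiveEquality : DecSetoid _ _
  projectiveEquality = record
    { Carrier = Vec
    ; _≈_ = _∼_
    ; isDecEquivalence = record
      { isEquivalence = record { refl = ∼-refl _ ; sym = ∼-sym ; trans = ∼-trans }
      ; _≟_ = _∼?_
      }
    }

  InV'-∼ : ∀ {a b} → a ∼ b → InV' a → InV' b
  InV'-∼ (l , l-unit , b≈la) (i , unit) = i , unit-resp (sym (b≈la i)) (unit-* l-unit unit)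

  ∑-class : ∀ {y} → InV' y → ∑[ z ∈ allTuples n ] 𝟙 (y ∼? z) ≡ ∣K×∣
  ∑-class {y} (j , y-unit) = begin
    ∑[ z ∈ allTuples n ] 𝟙 (y ∼? z)
      ≡⟨ ∑-cong (allTuples n) scalars ⟩
    ∑[ z ∈ allTuples n ] ∑[ l ∈ elems ] (𝟙 (IsUnit? l) *ℕ 𝟙 (multiple? l z))
      ≡⟨ ∑-comm (allTuples n) elems _ ⟩
    ∑[ l ∈ elems ] ∑[ z ∈ allTuples n ] (𝟙 (IsUnit? l) *ℕ 𝟙 (multiple? l z))
      ≡⟨ ∑-cong elems (λ l → *-distribˡ-∑ (𝟙 (IsUnit? l)) (allTuples n) _) ⟨
    ∑[ l ∈ elems ] (𝟙 (IsUnit? l) *ℕ ∑[ z ∈ allTuples n ] 𝟙 (multiple? l z))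
      ≡⟨ ∑-cong elems (λ l → ≡.cong (𝟙 (IsUnit? l) *ℕ_) (multiplesOf l)) ⟩
    ∑[ l ∈ elems ] (𝟙 (IsUnit? l) *ℕ 1)
      ≡⟨ ∑-cong elems (λ l → ℕ.*-identityʳ _) ⟩
    ∣K×∣ ∎
    where
    multiple? : ∀ l (z : Vec) → Dec (∀ i → z i ≈ l * y i)
    multiple? l z = all? (λ i → z i ≟ (l * y i))
    multiplesOf : ∀ l → ∑[ z ∈ allTuples n ] 𝟙 (multiple? l z) ≡ 1
    multiplesOf l = ≡.trans (∑-allTuples-all? n (λ i x → x ≟ (l * y i)) (λ i → ∑-δ (l * y i))) (ℕ.^-zeroˡ n)
    scalars : ∀ z → 𝟙 (y ∼? z) ≡ ∑[ l ∈ elems ] (𝟙 (IsUnit? l) *ℕ 𝟙 (multiple? l z))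
    scalars z = ≡.trans (unique (y ∼? z)) (∑-cong elems (λ l → 𝟙-× (IsUnit? l) (multiple? l z) _))
      where
      unique : (d : Dec (y ∼ z)) → 𝟙 d ≡ ∑[ l ∈ elems ] 𝟙 (IsUnit? l ×-dec multiple? l z)
      unique (yes (l , l∼)) = ≡.sym (∑-unique (λ l → IsUnit? l ×-dec multiple? l z)
        (λ l≈m (l-unit , z≈ly) → unit-resp l≈m l-unit , λ i → trans (z≈ly i) (*-congʳ l≈m))
        (λ (_ , z≈ly) (_ , z≈my) → unit-cancelˡ y-unit (trans (*-comm _ _) (trans (trans (sym (z≈ly j)) (z≈my j)) (*-comm _ _))))
        l∼)
      unique (no ¬y∼z) = ≡.sym (∑-𝟙-none _ elems (λ l l∼ → ¬y∼z (l , l∼)))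

  #classes-filter : ∀ {p} {P : Vec → Set p} (P? : ∀ a → Dec (P a)) → (∀ {a b} → a ∼ b → P a → P b) → (∀ {a} → P a → InV' a) →
                    length (filter P? (allTuples n)) ≡ ∣K×∣ *ℕ #classes _∼?_ (filter P? (allTuples n))
  #classes-filter {P = P} P? P-∼ P⇒V′ = Classes.length≡*#classes projectiveEquality (filter P? (allTuples n)) ∣K×∣
    (All.map (λ {b} Pb → classSize Pb) (All.all-filter P? (allTuples n)))
    where
    classSize : ∀ {b} → P b → ∑[ a ∈ filter P? (allTuples n) ] 𝟙 (b ∼? a) ≡ ∣K×∣
    classSize {b} Pb = begin
      ∑[ a ∈ filter P? (allTuples n) ] 𝟙 (b ∼? a)          ≡⟨ ∑-filter P? (allTuples n) _ ⟩
      ∑[ a ∈ allTuples n ] (𝟙 (P? a) *ℕ 𝟙 (b ∼? a))       ≡⟨ ∑-cong (allTuples n) inClass ⟩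
      ∑[ a ∈ allTuples n ] 𝟙 (b ∼? a)                     ≡⟨ ∑-class (P⇒V′ Pb) ⟩
      ∣K×∣                                                ∎
      where
      inClass : ∀ a → 𝟙 (P? a) *ℕ 𝟙 (b ∼? a) ≡ 𝟙 (b ∼? a)
      inClass a with b ∼? a
      ... | yes b∼a = ≡.cong (_*ℕ 1) (𝟙-yes (P? a) (P-∼ b∼a Pb))
      ... | no _ = ℕ.*-zeroʳ (𝟙 (P? a))

module Hyperplanes (F : FiniteCommRing) (r : FiniteCommRing.Carrier F) (three : Over.ExactlyThreeIdeals F r) (e : ℕ)
  (H : Over.WithJ.Dim.Hyperplane F r e) where
  open FiniteCommRing F hiding (zero)
  open Over F
  open WithJ r
  open Dim e
  open Hyperplane H
  open DotProduct F
  open ThreeIdeals F r three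
  open import Data.Product using (_,_)
  open import Relation.Binary.Reasoning.Setoid setoid

  Mem⇒InT : ∀ {v} → Mem v → InT v
  Mem⇒InT (c , v≈cB) i = J-resp (sym (v≈cB i)) (J-·ʳ c (λ j → basis∈T j i))

  Mem-resp : ∀ {v w} → (∀ i → v i ≈ w i) → Mem v → Mem w
  Mem-resp v≈w (c , v≈cB) = c , λ i → trans (sym (v≈w i)) (v≈cB i)

  Mem-combination : ∀ {v w} → Mem v → Mem w → ∀ a b → Mem (λ i → a * v i + b * w i)
  Mem-combination {v} {w} (c , v≈cB) (d , w≈dB) a b = (λ j → a * c j + b * d j) , λ i → begin
    a * v i + b * w i                                      ≈⟨ +-cong (*-congˡ (v≈cB i)) (*-congˡ (w≈dB i)) ⟩
    a * (c · (λ j → basis j i)) + b * (d · (λ j → basis j i)) ≈⟨ +-congʳ (·-scaleˡ a c _) ⟨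
    (λ j → a * c j) · (λ j → basis j i) + b * (d · (λ j → basis j i)) ≈⟨ ·-linearˡ _ d b _ ⟨
    (λ j → a * c j + b * d j) · (λ j → basis j i)          ∎

module CommonNeighbours (F : FiniteCommRing) (r : FiniteCommRing.Carrier F) (three : Over.ExactlyThreeIdeals F r) (e : ℕ) where
  open FiniteCommRing F hiding (zero)
  open Over F
  open WithJ r
  open Dim e
  open Units F
  open ElementSums F
  open DotProduct F
  open TupleSums F
  open ThreeIdeals F r three
  open ResidueCounts F r three
  open SumsOverJ F r three
  open Symplectic F r e
  open ProjectiveClasses F r e
  open ListSum
  open ℤ-RingSolver ring using (solve; _:=_; _:+_; _:*_; :-_; _:-_; con)
  open import Data.Nat using (_^_) renaming (_+_ to _+ℕ_; _*_ to _*ℕ_)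
  import Data.Nat.Properties as ℕ
  open import Data.Product using (∃; _×_; _,_; proj₁; proj₂)
  open import Data.Sum using (inj₁; inj₂)
  open import Function using (_∘_; _⇔_; Equivalence)
  open import Relation.Nullary using (Dec)
  open import Relation.Nullary.Decidable using (_×-dec_)

  module TwoVertices (H : Hyperplane) (u : Vec) (u∈V′ : InV' u) (ru∉H : ¬ Hyperplane.Mem H (r· u))
    (x y h h′ : Vec) (h∈H : Hyperplane.Mem H h) (h′∈H : Hyperplane.Mem H h′)
    (l l′ : Carrier) (l-unit : IsUnit l) (l′-unit : IsUnit l′)
    (x≈l[u+h] : ∀ i → x i ≈ l * (u i + h i)) (y≈l′[u+h′] : ∀ i → y i ≈ l′ * (u i + h′ i))
    (x≁y : ¬ x ∼ y) where
    open Hyperplanes F r three e H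

    x₀ y₀ : Vec
    x₀ i = u i + h i
    y₀ i = u i + h′ i

    h∈T : InT h
    h∈T = Mem⇒InT h∈H

    h′∈T : InT h′
    h′∈T = Mem⇒InT h′∈H

    δ : Vec
    δ i = proj₁ (J-sub (h′∈T i) (h∈T i))

    h′-h≈δr : ∀ i → h′ i - h i ≈ δ i * r
    h′-h≈δr i = proj₂ (J-sub (h′∈T i) (h∈T i))

    X E : Vec
    X = Ω x₀
    E = Ω δ

    module _ where
      open import Relation.Binary.Reasoning.Setoid setoid

      y₀≈x₀+rδ : ∀ i → y₀ i ≈ x₀ i + r * δ i
      y₀≈x₀+rδ i = begin
        u i + h′ i                  ≈⟨ solve 3 (λ u h h′ → u :+ h′ := (u :+ h) :+ (h′ :- h)) refl (u i) (h i) (h′ i) ⟩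
        x₀ i + (h′ i - h i)         ≈⟨ +-congˡ (trans (h′-h≈δr i) (*-comm (δ i) r)) ⟩
        x₀ i + r * δ i              ∎

      form-x : ∀ a → form a x ≈ l * (X · a)
      form-x a = trans (form-scaleʳ a l x≈l[u+h]) (*-congˡ (form≈Ω· a x₀))

      form-y : ∀ a → form a y ≈ l′ * (X · a + r * (E · a))
      form-y a = begin
        form a y                        ≈⟨ form-scaleʳ a l′ y≈l′[u+h′] ⟩
        l′ * form a y₀                  ≈⟨ *-congˡ (form≈Ω· a y₀) ⟩
        l′ * (Ω y₀ · a)                 ≈⟨ *-congˡ (·-cong (λ j → trans (Ω-cong y₀≈x₀+rδ j) (Ω-linear x₀ r δ j)) (λ _ → refl)) ⟩
        l′ * ((λ j → X j + r * E j) · a) ≈⟨ *-congˡ (·-linearˡ X E r a) ⟩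
        l′ * (X · a + r * (E · a))      ∎

      x₀-unitEntry : ∃ λ i → IsUnit (x₀ i)
      x₀-unitEntry = let (i , unit) = u∈V′ in i , unit-+J unit (h∈T i)

      rs·x₀≈h-h′ : ∀ s → (λ i → δ i + s * x₀ i) ∈Jᵐ → ∀ i → (r * s) * x₀ i ≈ h i - h′ i
      rs·x₀≈h-h′ s dependent i = begin
        (r * s) * x₀ i
          ≈⟨ solve 4 (λ c x h h′ → c :* x := ((h′ :- h) :+ c :* x) :+ (h :- h′)) refl (r * s) (x₀ i) (h i) (h′ i) ⟩
        ((h′ i - h i) + (r * s) * x₀ i) + (h i - h′ i)  ≈⟨ +-congʳ (+-congʳ (h′-h≈δr i)) ⟩
        (δ i * r + (r * s) * x₀ i) + (h i - h′ i)
          ≈⟨ +-congʳ (solve 4 (λ d r s x → d :* r :+ (r :* s) :* x := r :* (d :+ s :* x)) refl (δ i) r s (x₀ i)) ⟩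
        r * (δ i + s * x₀ i) + (h i - h′ i)             ≈⟨ +-congʳ (r*J≈0 (dependent i)) ⟩
        0# + (h i - h′ i)                               ≈⟨ +-identityˡ _ ⟩
        h i - h′ i                                      ∎

      -- δ + s x₀ ∈ J²ᵉ means h - h′ = rs·x₀: for s ∈ J this forces h = h′, for a unit s it puts ru into H.
      δ+sx₀∉Jⁿ : ∀ s → ¬ (λ i → δ i + s * x₀ i) ∈Jᵐ
      δ+sx₀∉Jⁿ s dependent with unit⊎∈J s
      ... | inj₂ s∈J = x≁y (l′ * l⁻¹ , unit-* l′-unit (unit-inverse l-unit) , y≈l′l⁻¹x)
        where
        l⁻¹ : Carrier
        l⁻¹ = proj₁ l-unit
        h′≈h : ∀ i → h′ i ≈ h i
        h′≈h i = begin
          h′ i                   ≈⟨ solve 2 (λ h h′ → h′ := h :- (h :- h′)) refl (h i) (h′ i) ⟩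
          h i - (h i - h′ i)     ≈⟨ +-congˡ (-‿cong (sym (rs·x₀≈h-h′ s dependent i))) ⟩
          h i - (r * s) * x₀ i   ≈⟨ +-congˡ (-‿cong (trans (*-congʳ (r*J≈0 s∈J)) (zeroˡ _))) ⟩
          h i - 0#               ≈⟨ solve 1 (λ h → h :- con (ℤ.+ 0) := h) refl (h i) ⟩
          h i                    ∎
        y≈l′l⁻¹x : ∀ i → y i ≈ l′ * l⁻¹ * x i
        y≈l′l⁻¹x i = begin
          y i                    ≈⟨ y≈l′[u+h′] i ⟩
          l′ * (u i + h′ i)      ≈⟨ *-congˡ (+-congˡ (h′≈h i)) ⟩
          l′ * x₀ i              ≈⟨ *-congˡ (uv≈1⇒v[ua]≈a (proj₂ l-unit) (x₀ i)) ⟨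
          l′ * (l⁻¹ * (l * x₀ i)) ≈⟨ *-congˡ (*-congˡ (x≈l[u+h] i)) ⟨
          l′ * (l⁻¹ * x i)       ≈⟨ *-assoc l′ l⁻¹ (x i) ⟨
          l′ * l⁻¹ * x i         ∎
      ... | inj₁ (v , sv≈1) = ru∉H (Mem-resp ru≈vh-vh′ (Mem-combination h∈H h′∈H v (- v)))
        where
        ru≈vh-vh′ : ∀ i → v * h i + - v * h′ i ≈ r * u i
        ru≈vh-vh′ i = sym (begin
          r * u i                        ≈⟨ uv≈1⇒v[ua]≈a sv≈1 (r * u i) ⟨
          v * (s * (r * u i))            ≈⟨ *-congˡ (solve 4 (λ s r u h → s :* (r :* u) := (r :* s) :* (u :+ h) :- s :* (r :* h)) refl s r (u i) (h i)) ⟩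
          v * ((r * s) * x₀ i - s * (r * h i)) ≈⟨ *-congˡ (+-cong (rs·x₀≈h-h′ s dependent i) (-‿cong (trans (*-congˡ (r*J≈0 (h∈T i))) (zeroʳ s)))) ⟩
          v * ((h i - h′ i) - 0#)        ≈⟨ solve 3 (λ v h h′ → v :* ((h :- h′) :- con (ℤ.+ 0)) := v :* h :+ (:- v) :* h′) refl v (h i) (h′ i) ⟩
          v * h i + - v * h′ i           ∎)

      E+sX-unitEntry : ∀ s → ∃ λ j → IsUnit (E j + s * X j)
      E+sX-unitEntry s with Ω-unitEntry (∉Jᵐ⇒unitEntry _ (δ+sx₀∉Jⁿ s))
      ... | j , unit = j , unit-resp (Ω-linear δ s x₀ j) unit

      Adj-x⇔ : ∀ a → Adj a x ⇔ J∖0 (X · a)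
      Adj-x⇔ a = J∖0-unitMultiple l-unit (form-x a)

      Adj-y⇔ : ∀ a → Adj a y ⇔ J∖0 (X · a + r * (E · a))
      Adj-y⇔ a = J∖0-unitMultiple l′-unit (form-y a)

      Adj-∼ˡ : ∀ {a a′} b → a ∼ a′ → Adj a b → Adj a′ b
      Adj-∼ˡ b (m , m-unit , a′≈ma) = Equivalence.from (J∖0-unitMultiple m-unit (form-scaleˡ m b a′≈ma))

    Φ : Carrier → Carrier → ℕ
    Φ α γ = 𝟙 (J∖0? α) *ℕ 𝟙 (J∖0? (α + r * γ))

    Φ-respˡ : ∀ {α α′} γ → α ≈ α′ → Φ α γ ≡ Φ α′ γ
    Φ-respˡ γ α≈α′ = ≡.cong₂ _*ℕ_ (𝟙J∖0-resp α≈α′) (𝟙J∖0-resp (+-congʳ α≈α′))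

    Φ-respʳ : ∀ α {γ γ′} → J (γ - γ′) → Φ α γ ≡ Φ α γ′
    Φ-respʳ α γ-γ′∈J = ≡.cong (𝟙 (J∖0? α) *ℕ_) (𝟙J∖0-resp (+-congˡ (a-b∈J⇒ra≈rb γ-γ′∈J)))

    open TwoLinearForms F r three Φ-respˡ Φ-respʳ using (Φ-resp; ∑Φ; ∑-twoLinearForms)

    module _ where
      open ≡.≡-Reasoning

      commonNeighbour? : ∀ a → Dec (InV' a × (Adj a x × Adj a y))
      commonNeighbour? a = InV'? a ×-dec (Adj? a x ×-dec Adj? a y)

      #common #forms #formsᴶ : ℕ
      #common = ∑[ a ∈ allTuples n ] 𝟙 (commonNeighbour? a)
      #forms = ∑[ a ∈ allTuples n ] Φ (X · a) (E · a)
      #formsᴶ = ∑[ a ∈ allTuples n ] (𝟙 (a ∈Jᵐ?) *ℕ 𝟙 (J∖0? (X · a)))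

      #common≡∣K×∣*commonNeighbours : #common ≡ ∣K×∣ *ℕ commonNeighbours x y
      #common≡∣K×∣*commonNeighbours = ≡.trans (≡.sym (length-filter commonNeighbour? (allTuples n)))
        (#classes-filter commonNeighbour?
          (λ a∼b (a∈V′ , a~x , a~y) → InV'-∼ a∼b a∈V′ , Adj-∼ˡ x a∼b a~x , Adj-∼ˡ y a∼b a~y) proj₁)

      #common+#formsᴶ≡#forms : #common +ℕ #formsᴶ ≡ #forms
      #common+#formsᴶ≡#forms = ≡.trans (≡.sym (∑-distrib-+ (allTuples n) _ _)) (∑-cong (allTuples n) split)
        where
        split : ∀ a → 𝟙 (commonNeighbour? a) +ℕ 𝟙 (a ∈Jᵐ?) *ℕ 𝟙 (J∖0? (X · a)) ≡ Φ (X · a) (E · a)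
        split a with a ∈Jᵐ?
        ... | yes a∈Jⁿ = begin
          𝟙 (commonNeighbour? a) +ℕ 1 *ℕ 𝟙 (J∖0? (X · a))
            ≡⟨ ≡.cong₂ _+ℕ_ (𝟙-no (commonNeighbour? a) (λ ((i , unit) , _) → unit⇒∉J unit (a∈Jⁿ i))) (ℕ.*-identityˡ _) ⟩
          𝟙 (J∖0? (X · a))                                 ≡⟨ 𝟙-idem (J∖0? (X · a)) ⟨
          𝟙 (J∖0? (X · a)) *ℕ 𝟙 (J∖0? (X · a))             ≡⟨ ≡.cong (𝟙 (J∖0? (X · a)) *ℕ_) (𝟙J∖0-resp (sym X·a+rE·a≈X·a)) ⟩
          Φ (X · a) (E · a)                                ∎
          where
          X·a+rE·a≈X·a : X · a + r * (E · a) ≈ X · a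
          X·a+rE·a≈X·a = trans (+-congˡ (r*J≈0 (J-·ʳ E a∈Jⁿ))) (+-identityʳ _)
        ... | no a∉Jⁿ = begin
          𝟙 (commonNeighbour? a) +ℕ 0                      ≡⟨ ℕ.+-identityʳ _ ⟩
          𝟙 (commonNeighbour? a)
            ≡⟨ 𝟙-cong (commonNeighbour? a) (J∖0? (X · a) ×-dec J∖0? (X · a + r * (E · a)))
                 (λ (_ , a~x , a~y) → Equivalence.to (Adj-x⇔ a) a~x , Equivalence.to (Adj-y⇔ a) a~y)
                 (λ (x-form , y-form) → ∉Jᵐ⇒unitEntry a a∉Jⁿ , Equivalence.from (Adj-x⇔ a) x-form , Equivalence.from (Adj-y⇔ a) y-form) ⟩
          𝟙 (J∖0? (X · a) ×-dec J∖0? (X · a + r * (E · a))) ≡⟨ 𝟙-× (J∖0? (X · a)) (J∖0? (X · a + r * (E · a))) _ ⟩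
          Φ (X · a) (E · a)                                ∎

      X-unitEntry : ∃ λ j → IsUnit (X j)
      X-unitEntry = Ω-unitEntry x₀-unitEntry

      #formsᴶ*q≡qⁿ*∣J∖0∣ : #formsᴶ *ℕ q ≡ q ^ n *ℕ ∣J∖0∣
      #formsᴶ*q≡qⁿ*∣J∖0∣ = begin
        #formsᴶ *ℕ q
          ≡⟨ ≡.cong (_*ℕ q) (∑-cong (allTuples n) (λ a → ≡.cong (𝟙 (a ∈Jᵐ?) *ℕ_) (𝟙J∖0-resp (sym (+-identityˡ (X · a)))))) ⟩
        ∑[ a ∈ allTuples n ] (𝟙 (a ∈Jᵐ?) *ℕ 𝟙 (J∖0? (0# + X · a))) *ℕ q
          ≡⟨ ∑-linearFormᴶ n X X-unitEntry 0# 𝟙J∖0-resp ⟩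
        q ^ n *ℕ ∑ᴶ (λ j → 𝟙 (J∖0? (0# + j)))
          ≡⟨ ≡.cong (q ^ n *ℕ_) (∑-cong elems (λ j → ≡.trans (≡.cong (𝟙 (J? j) *ℕ_) (𝟙J∖0-resp (+-identityˡ j)))
                                                                 (𝟙-*-implied (J∖0? j) (J? j) proj₁))) ⟩
        q ^ n *ℕ ∣J∖0∣ ∎

      #forms*∣K∣²≡∣K∣ⁿ*∑Φ : #forms *ℕ (∣K∣ *ℕ ∣K∣) ≡ ∣K∣ ^ n *ℕ ∑Φ
      #forms*∣K∣²≡∣K∣ⁿ*∑Φ = ≡.trans
        (≡.cong (_*ℕ (∣K∣ *ℕ ∣K∣)) (∑-cong (allTuples n) (λ a → Φ-resp (sym (+-identityˡ _)) (sym (+-identityˡ _)))))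
        (∑-twoLinearForms n X E X-unitEntry E+sX-unitEntry 0# 0#)

      ∑Φ+∣J∖0∣*q≡∣J∖0∣*∣K∣ : ∑Φ +ℕ ∣J∖0∣ *ℕ q ≡ ∣J∖0∣ *ℕ ∣K∣
      ∑Φ+∣J∖0∣*q≡∣J∖0∣*∣K∣ = begin
        ∑Φ +ℕ ∣J∖0∣ *ℕ q
          ≡⟨ ≡.cong₂ _+ℕ_ (∑-cong elems (λ α → ≡.sym (*-distribˡ-∑ (𝟙 (J∖0? α)) elems _))) (*-distribʳ-∑ q elems _) ⟩
        ∑[ α ∈ elems ] (𝟙 (J∖0? α) *ℕ shifted α) +ℕ ∑[ α ∈ elems ] (𝟙 (J∖0? α) *ℕ q)
          ≡⟨ ∑-distrib-+ elems _ _ ⟨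
        ∑[ α ∈ elems ] (𝟙 (J∖0? α) *ℕ shifted α +ℕ 𝟙 (J∖0? α) *ℕ q)
          ≡⟨ ∑-cong elems (λ α → ≡.trans (≡.sym (ℕ.*-distribˡ-+ (𝟙 (J∖0? α)) _ q)) (𝟙*-cong (J∖0? α) (∑-J∖0-shift ∘ proj₁))) ⟩
        ∑[ α ∈ elems ] (𝟙 (J∖0? α) *ℕ (q *ℕ q))
          ≡⟨ *-distribʳ-∑ (q *ℕ q) elems _ ⟨
        ∣J∖0∣ *ℕ (q *ℕ q)
          ≡⟨ ≡.cong (∣J∖0∣ *ℕ_) ∣K∣≡q*q ⟨
        ∣J∖0∣ *ℕ ∣K∣ ∎
        where
        shifted : Carrier → ℕ
        shifted α = ∑[ γ ∈ elems ] 𝟙 (J∖0? (α + r * γ))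

module Arithmetic where
  open import Data.Nat
  open import Data.Nat.Properties
  open import Data.Nat.Tactic.RingSolver using (solve)
  open import Algebra.Properties.CommutativeSemigroup *-commutativeSemigroup using () renaming (interchange to *-interchange)
  open import Data.List using (_∷_; [])
  open ≡ using (_≢_; cong; cong₂; sym; trans)
  open ≡.≡-Reasoning

  ^-*-comm : ∀ q n k → q ^ (n * k) ≡ (q ^ k) ^ n
  ^-*-comm q n k = trans (cong (q ^_) (*-comm n k)) (sym (^-*-assoc q k n))

  ^-*-suc∸ : ∀ q n k → q ^ (n * suc k ∸ n) ≡ (q ^ k) ^ n
  ^-*-suc∸ q n k = trans (cong (λ m → q ^ (m ∸ n)) (*-suc n k)) (trans (cong (q ^_) (m+n∸m≡n n (n * k))) (^-*-comm q n k))

  ^-distribʳ-* : ∀ a b n → (a * b) ^ n ≡ a ^ n * b ^ n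
  ^-distribʳ-* a b zero = ≡.refl
  ^-distribʳ-* a b (suc n) = trans (cong (a * b *_) (^-distribʳ-* a b n)) (*-interchange a b (a ^ n) (b ^ n))

  private
    solveCounts : ∀ p B {CN U S T₁ T₂ T₃} → .{{NonZero p}} →
      T₃ ≡ U * CN → U + suc p ≡ suc p * suc p → T₃ + T₂ ≡ T₁ →
      T₂ * suc p ≡ suc p * B * (suc p * B) * p →
      T₁ * (suc p * suc p * (suc p * suc p)) ≡ suc p * B * (suc p * B) * (suc p * B * (suc p * B)) * S →
      S + p * suc p ≡ p * (suc p * suc p) →
      CN + B ^ 4 + B ^ 2 ≡ suc p * B ^ 4
    solveCounts p B {CN} {U} {S} {T₁} {T₂} {T₃} T₃≡U*CN U+q≡q² T₃+T₂≡T₁ T₂q≡ T₁K²≡ S+pq≡pK = begin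
      CN + B ^ 4 + B ^ 2                                ≡⟨⟩
      CN + B * (B * (B * (B * 1))) + B * (B * 1)        ≡⟨ solve (CN ∷ B ∷ []) ⟩
      (CN + B * B) + B * B * B * B                      ≡⟨ cong (_+ B * B * B * B) CN+B²≡B⁴p ⟩
      B * B * B * B * p + B * B * B * B                 ≡⟨ solve (B ∷ p ∷ []) ⟩
      suc p * (B * (B * (B * (B * 1))))                 ≡⟨⟩
      suc p * B ^ 4                                     ∎
      where
      U≡pq : U ≡ p * suc p
      U≡pq = +-cancelʳ-≡ (suc p) U (p * suc p) (trans U+q≡q² (solve (p ∷ [])))
      S≡ppq : S ≡ p * p * suc p
      S≡ppq = +-cancelʳ-≡ (p * suc p) S (p * p * suc p) (trans S+pq≡pK (solve (p ∷ [])))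
      T₂≡qB²p : T₂ ≡ suc p * B * B * p
      T₂≡qB²p = *-cancelʳ-≡ T₂ _ (suc p) (trans T₂q≡ (solve (p ∷ B ∷ [])))
      T₁≡qB⁴p² : T₁ ≡ suc p * (B * B * B * B) * p * p
      T₁≡qB⁴p² = *-cancelʳ-≡ T₁ _ (suc p * suc p * (suc p * suc p))
        (trans T₁K²≡ (trans (cong (suc p * B * (suc p * B) * (suc p * B * (suc p * B)) *_) S≡ppq) (solve (p ∷ B ∷ []))))
      CN+B²≡B⁴p : CN + B * B ≡ B * B * B * B * p
      CN+B²≡B⁴p = *-cancelʳ-≡ _ _ (p * suc p) {{m*n≢0 p (suc p)}} (begin
        (CN + B * B) * (p * suc p)          ≡⟨ solve (CN ∷ B ∷ p ∷ []) ⟩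
        p * suc p * CN + suc p * B * B * p  ≡⟨ cong₂ _+_ (cong (_* CN) (sym U≡pq)) (sym T₂≡qB²p) ⟩
        U * CN + T₂                         ≡⟨ cong (_+ T₂) (sym T₃≡U*CN) ⟩
        T₃ + T₂                             ≡⟨ T₃+T₂≡T₁ ⟩
        T₁                                  ≡⟨ T₁≡qB⁴p² ⟩
        suc p * (B * B * B * B) * p * p     ≡⟨ solve (B ∷ p ∷ []) ⟩
        B * B * B * B * p * (p * suc p)     ∎)

  commonNeighbourCount : ∀ {p q K CN U S T₁ T₂ T₃} k → p ≢ 0 → p + 1 ≡ q → K ≡ q * q →
    T₃ ≡ U * CN → U + q ≡ q * q → T₃ + T₂ ≡ T₁ →
    T₂ * q ≡ q ^ (suc k + suc k) * p → T₁ * (K * K) ≡ K ^ (suc k + suc k) * S → S + p * q ≡ p * K →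
    CN + q ^ (4 * suc k ∸ 4) + q ^ (2 * suc k ∸ 2) ≡ q ^ (4 * suc k ∸ 3)
  commonNeighbourCount {p} {q} {K} {CN} {U} {S} k p≢0 p+1≡q K≡q² T₃≡U*CN U+q≡q² T₃+T₂≡T₁ T₂q≡ T₁K²≡ S+pq≡pK
    with trans (+-comm 1 p) p+1≡q | K≡q²
  ... | ≡.refl | ≡.refl = begin
    CN + q ^ (4 * suc k ∸ 4) + q ^ (2 * suc k ∸ 2) ≡⟨ cong₂ (λ m n → CN + m + n) (^-*-suc∸ q 4 k) (^-*-suc∸ q 2 k) ⟩
    CN + (q ^ k) ^ 4 + (q ^ k) ^ 2                 ≡⟨ solveCounts p (q ^ k) {{≢-nonZero p≢0}} T₃≡U*CN U+q≡q² T₃+T₂≡T₁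
                                                         (trans T₂q≡ (cong (_* p) qⁿ))
                                                         (trans T₁K²≡ (cong (_* S) (trans (^-distribʳ-* q q (suc k + suc k)) (cong₂ _*_ qⁿ qⁿ))))
                                                         S+pq≡pK ⟩
    q * (q ^ k) ^ 4                                ≡⟨ cong (q *_) (^-*-comm q 4 k) ⟨
    q ^ (1 + 4 * k)                                ≡⟨ cong (λ m → q ^ (m ∸ 3)) (*-suc 4 k) ⟨
    q ^ (4 * suc k ∸ 3)                            ∎
    where
    qⁿ : q ^ (suc k + suc k) ≡ q ^ suc k * q ^ suc k
    qⁿ = ^-distribˡ-+-* q (suc k) (suc k)

open import Data.Nat using (_≤_; _+_; _*_; _∸_; _^_; s≤s; z≤n)
open import Data.Product using (_,_)

proposition3p13 :
    (F : FiniteCommRing) (r : FiniteCommRing.Carrier F) →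
    Over.ExactlyThreeIdeals F r →
    (q : ℕ) → IsPrimePower q → Over.WithJ.residueSize F r ≡ q →
    (e : ℕ) → 2 ≤ e →
    let open Over.WithJ.Dim F r e in
    (H : Hyperplane) (u : Vec) → InV' u → ¬ Hyperplane.Mem H (r· u) →
    (x y : Vec) → InC H u x → InC H u y → ¬ (x ∼ y) →
    commonNeighbours x y + q ^ (4 * e ∸ 4) + q ^ (2 * e ∸ 2) ≡ q ^ (4 * e ∸ 3)
proposition3p13 F r three _ _ ≡.refl (suc (suc k)) (s≤s (s≤s z≤n)) H u u∈V′ ru∉H x y
                (_ , h , h∈H , l , l-unit , x≈l[u+h]) (_ , h′ , h′∈H , l′ , l′-unit , y≈l′[u+h′]) x≁y =
  Arithmetic.commonNeighbourCount (suc k) ∣J∖0∣≢0 ∣J∖0∣+1≡q ∣K∣≡q*q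
    #common≡∣K×∣*commonNeighbours ∣K×∣+q≡q*q #common+#formsᴶ≡#forms
    #formsᴶ*q≡qⁿ*∣J∖0∣ #forms*∣K∣²≡∣K∣ⁿ*∑Φ ∑Φ+∣J∖0∣*q≡∣J∖0∣*∣K∣
  where
  open ResidueCounts F r three
  open CommonNeighbours F r three (suc (suc k))
  open TwoVertices H u u∈V′ ru∉H x y h h′ h∈H h′∈H l l′ l-unit l′-unit x≈l[u+h] y≈l′[u+h′] x≁y
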